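{- Let $p$ be an odd prime and $\alpha,\beta\in\mathbb Z_p$. If $\langle-\alpha\rangle_p+\langle-\beta\rangle_p<p$, then $$ {}_2F_1\bigg[\begin{matrix}\alpha&\beta\\&1\end{matrix}\bigg|\,1\bigg]_{p-1}\equiv-\frac{\Gamma_p(1-\alpha-\beta)}{\Gamma_p(1-\alpha)\Gamma_p(1-\beta)}\pmod{p^2}. $$ If $\langle-\alpha\rangle_p+\langle-\beta\rangle_p\geq p$, then $$ {}_2F_1\bigg[\begin{matrix}\alpha&\beta\\&1\end{matrix}\bigg|\,1\bigg]_{p-1}\equiv\big(\alpha+\beta+\langle-\alpha\rangle_p+\langle-\beta\rangle_p-p\big)\cdot\frac{\Gamma_p(1-\alpha-\beta)}{\Gamma_p(1-\alpha)\Gamma_p(1-\beta)}\pmod{p^2}. $$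
   Context: $\mathbb Z_p$ denotes the $p$-adic integers. For $\alpha\in\mathbb Z_p$, $\langle\alpha\rangle_p$ is the unique integer in $\{0,1,\ldots,p-1\}$ congruent to $\alpha$ modulo $p$. Pochhammer symbol: $(x)_0=1$, $(x)_k=x(x+1)\cdots(x+k-1)$ for $k\ge1$. For $n\ge 0$ the truncated hypergeometric series is ${}_{m+1}F_m\Big[\begin{matrix}\alpha_0&\alpha_1&\ldots&\alpha_m\\&\beta_1&\ldots&\beta_m\end{matrix}\Big|\,z\Big]_n=\sum_{k=0}^{n}\frac{(\alpha_0)_k\cdots(\alpha_m)_k}{(\beta_1)_k\cdots(\beta_m)_k}\cdot\frac{z^k}{k!}$. $\Gamma_p$ is Morita's $p$-adic gamma function: $\Gamma_p(n)=(-1)^n\prod_{1\le j<n,\ p\nmid j}j$ for integers $n\ge1$, $\Gamma_p(0)=1$, extended to $\mathbb Z_p$ by continuity. For $x,y\in\mathbb Q_p$, $x\equiv y\pmod{p^2}$ means $x-y\in p^2\mathbb Z_p$. -}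

module Defs where

open import Data.Nat as ℕ using (ℕ; zero; suc; _!)
open import Data.Integer as ℤ using (ℤ; +_)
open import Data.Integer.DivMod using (_%ℕ_)
open import Data.Integer.Divisibility using (_∣_)
open import Data.List using (List; []; _∷_; foldr; upTo; filterᵇ; map)
open import Data.Bool using (not)

-- p-adic integers, represented by coherent sequences of integer approximants:
-- approx n is congruent to the p-adic integer modulo p^n.
record ℤₚ (p : ℕ) : Set where
  field
    approx   : ℕ → ℤ
    coherent : ∀ n → (+ (p ℕ.^ n)) ∣ (approx (suc n) ℤ.- approx n)
open ℤₚ public

-- "levelwise" p-adic quantities: the n-th entry is the value modulo p^n
Seq : Set
Seq = ℕ → ℤ

-- least non-negative residue of an integer modulo m (m = 0 gives 0, never used)
modN : ℤ → ℕ → ℕ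
modN x zero    = 0
modN x (suc m) = x %ℕ (suc m)

cst : ℤ → Seq
cst c _ = c

_⊕_ : Seq → Seq → Seq
(x ⊕ y) n = x n ℤ.+ y n

_⊗_ : Seq → Seq → Seq
(x ⊗ y) n = x n ℤ.* y n

⊖_ : Seq → Seq
(⊖ x) n = ℤ.- x n

infixl 6 _⊕_
infixl 7 _⊗_

-- inverse of a p-adic unit, levelwise via Euler: u⁻¹ ≡ u^(φ(p^n) - 1) mod p^n
inv : ℕ → Seq → Seq
inv p x zero    = + 0
inv p x (suc n) = x (suc n) ℤ.^ ((p ℕ.^ n) ℕ.* (p ℕ.∸ 1) ℕ.∸ 1)

⟨_⟩ : Seq → ℕ → ℕ
⟨_⟩ x p = modN (x 1) p

ΓpN : ℕ → ℕ → ℤ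
ΓpN p n = (ℤ.- + 1) ℤ.^ n ℤ.*
  + foldr ℕ._*_ 1 (filterᵇ (λ j → not (modN (+ j) p ℕ.≡ᵇ 0)) (map suc (upTo (n ℕ.∸ 1))))

-- Γ_p on ℤ_p, defined by continuity: modulo p^n, Γ_p(x) ≡ Γ_p(r) where r ∈ [0,p^n)
-- is the representative of x modulo p^n.
Γp : ℕ → Seq → Seq
Γp p x n = ΓpN p (modN (x n) (p ℕ.^ n))

poch : Seq → ℕ → Seq
poch x zero    = cst (+ 1)
poch x (suc k) = poch x k ⊗ (x ⊕ cst (+ k))

₂F₁-trunc : ℕ → Seq → Seq → ℕ → Seq
₂F₁-trunc p α β zero    = poch α 0 ⊗ poch β 0 ⊗ inv p (poch (cst (+ 1)) 0) ⊗ inv p (cst (+ (0 !)))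
₂F₁-trunc p α β (suc k) = ₂F₁-trunc p α β k
  ⊕ poch α (suc k) ⊗ poch β (suc k) ⊗ inv p (poch (cst (+ 1)) (suc k)) ⊗ inv p (cst (+ (suc k !)))

_≡_[modp²_] : Seq → Seq → ℕ → Set
x ≡ y [modp² p ] = (+ (p ℕ.^ 2)) ∣ (x 2 ℤ.- y 2)

-- All p-adic quantities are compared at level 2, i.e. as integers modulo p², where units are
-- inverted by Euler's theorem. Write a ≡ -A and b ≡ -B (mod p) with 0 ≤ A, B < p. As (a)_k - (-A)_k
-- and (b)_k - (-B)_k are multiples of p, the truncated sum is, modulo p², a combination of three
-- terminating sums ₂F₁(x, -B; 1 | 1), which Chu–Vandermonde evaluates to (1 - x)_B / B!.
-- The functional equation Γ_p(n + 1) = -n Γ_p(n) (p ∤ n) turns each rising factorial (n)_m into a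
-- ratio of Γ_p-values, up to the product of the multiples of p in [n, n + m).
-- If A + B < p there are no such multiples, and the first-order expansion
-- Γ_p(x + kp) ≡ Γ_p(x) (1 + k δ(x)) (mod p²), where p ∣ δ(x) by Wilson's theorem and δ is p-periodic
-- modulo p², combines the three terms into Γ_p(1 - a - b).
-- If A + B ≥ p each window contains exactly one multiple of p, so every term is a multiple of p, only
-- Γ_p modulo p matters, and the three multiples add up to -(a + b + A + B - p) modulo p².

module Submission where

open import Defs
open import Data.Nat using (ℕ; zero; suc)
open import Data.Nat.Primality using (Prime; ¬prime[0]; ¬prime[1])
open import Data.Product using (_×_; _,_)
open import Data.Empty using (⊥-elim)
open import Relation.Binary.PropositionalEquality using (_≢_)

module Congruence where

  open import Data.Nat as ℕ using (ℕ; zero; suc)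
  open import Data.Integer as ℤ using (ℤ; +_; _+_; _*_; -_; _-_)
  import Data.Integer.Properties as ℤP
  open import Data.Integer.Divisibility.Signed
  open import Data.Integer.DivMod using (_%ℕ_; _/ℕ_; a≡a%ℕn+[a/ℕn]*n)
  open import Data.Integer.Tactic.RingSolver using (solve-∀)
  open import Relation.Binary.Bundles using (Setoid)
  open import Relation.Binary.PropositionalEquality
  import Relation.Binary.Reasoning.Setoid as SetoidReasoning

  infix 4 _≡_[mod_]
  record _≡_[mod_] (x y m : ℤ) : Set where
    constructor ∣⇒≡-mod
    field ≡-mod⇒∣ : m ∣ x - y
  open _≡_[mod_] public

  ∣-resp-≡ : ∀ {m x y} → x ≡ y → m ∣ x → m ∣ y
  ∣-resp-≡ refl d = d

  module _ {m : ℤ} where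

    mod-reflexive : ∀ {x y} → x ≡ y → x ≡ y [mod m ]
    mod-reflexive {x} refl = ∣⇒≡-mod (divides (+ 0) (trans (ℤP.+-inverseʳ x) (sym (ℤP.*-zeroˡ m))))

    mod-refl : ∀ {x} → x ≡ x [mod m ]
    mod-refl = mod-reflexive refl

    mod-sym : ∀ {x y} → x ≡ y [mod m ] → y ≡ x [mod m ]
    mod-sym {x} {y} (∣⇒≡-mod d) = ∣⇒≡-mod (∣-resp-≡ (lemma x y) (∣m⇒∣-m d))
      where
      lemma : ∀ x y → - (x - y) ≡ y - x
      lemma = solve-∀

    mod-trans : ∀ {x y z} → x ≡ y [mod m ] → y ≡ z [mod m ] → x ≡ z [mod m ]
    mod-trans {x} {y} {z} (∣⇒≡-mod d) (∣⇒≡-mod e) = ∣⇒≡-mod (∣-resp-≡ (lemma x y z) (∣m∣n⇒∣m+n d e))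
      where
      lemma : ∀ x y z → (x - y) + (y - z) ≡ x - z
      lemma = solve-∀

    mod-setoid : Setoid _ _
    mod-setoid = record
      { Carrier = ℤ
      ; _≈_ = _≡_[mod m ]
      ; isEquivalence = record { refl = mod-refl ; sym = mod-sym ; trans = mod-trans }
      }

    +-cong : ∀ {x y u v} → x ≡ y [mod m ] → u ≡ v [mod m ] → x + u ≡ y + v [mod m ]
    +-cong {x} {y} {u} {v} (∣⇒≡-mod d) (∣⇒≡-mod e) = ∣⇒≡-mod (∣-resp-≡ (lemma x y u v) (∣m∣n⇒∣m+n d e))
      where
      lemma : ∀ x y u v → (x - y) + (u - v) ≡ x + u - (y + v)
      lemma = solve-∀

    +-congˡ : ∀ c {x y} → x ≡ y [mod m ] → c + x ≡ c + y [mod m ]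
    +-congˡ c d = +-cong (mod-refl {c}) d

    +-congʳ : ∀ c {x y} → x ≡ y [mod m ] → x + c ≡ y + c [mod m ]
    +-congʳ c d = +-cong d (mod-refl {c})

    neg-cong : ∀ {x y} → x ≡ y [mod m ] → - x ≡ - y [mod m ]
    neg-cong {x} {y} (∣⇒≡-mod d) = ∣⇒≡-mod (∣-resp-≡ (lemma x y) (∣m⇒∣-m d))
      where
      lemma : ∀ x y → - (x - y) ≡ - x - - y
      lemma = solve-∀

    sub-cong : ∀ {x y u v} → x ≡ y [mod m ] → u ≡ v [mod m ] → x - u ≡ y - v [mod m ]
    sub-cong d e = +-cong d (neg-cong e)

    *-cong : ∀ {x y u v} → x ≡ y [mod m ] → u ≡ v [mod m ] → x * u ≡ y * v [mod m ]
    *-cong {x} {y} {u} {v} (∣⇒≡-mod d) (∣⇒≡-mod e) =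
      ∣⇒≡-mod (∣-resp-≡ (lemma x y u v) (∣m∣n⇒∣m+n (∣n⇒∣m*n x e) (∣m⇒∣m*n v d)))
      where
      lemma : ∀ x y u v → x * (u - v) + (x - y) * v ≡ x * u - y * v
      lemma = solve-∀

    *-congˡ : ∀ c {x y} → x ≡ y [mod m ] → c * x ≡ c * y [mod m ]
    *-congˡ c d = *-cong (mod-refl {c}) d

    *-congʳ : ∀ c {x y} → x ≡ y [mod m ] → x * c ≡ y * c [mod m ]
    *-congʳ c d = *-cong d (mod-refl {c})

    ^-cong : ∀ {x y} n → x ≡ y [mod m ] → x ℤ.^ n ≡ y ℤ.^ n [mod m ]
    ^-cong zero    d = mod-refl
    ^-cong (suc n) d = *-cong d (^-cong n d)

  module ModReasoning (m : ℤ) = SetoidReasoning (mod-setoid {m})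

  ∣⇒≡0 : ∀ {m x} → m ∣ x → x ≡ + 0 [mod m ]
  ∣⇒≡0 {x = x} d = ∣⇒≡-mod (∣-resp-≡ (sym (ℤP.+-identityʳ x)) d)

  %ℕ-residue : ∀ x n .{{_ : ℕ.NonZero n}} → x ≡ + (x %ℕ n) [mod + n ]
  %ℕ-residue x n = ∣⇒≡-mod (divides (x /ℕ n)
    (trans (cong (_- + (x %ℕ n)) (a≡a%ℕn+[a/ℕn]*n x n)) (lemma (+ (x %ℕ n)) (x /ℕ n * + n))))
    where
    lemma : ∀ a b → a + b - a ≡ b
    lemma = solve-∀

  pos-+-cong-mod : ∀ {m n c} k → + n ≡ + c [mod m ] → + (n ℕ.+ k) ≡ + (c ℕ.+ k) [mod m ]
  pos-+-cong-mod {n = n} {c} k n≡c =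
    mod-trans (mod-reflexive (ℤP.pos-+ n k)) (mod-trans (+-congʳ (+ k) n≡c) (mod-reflexive (sym (ℤP.pos-+ c k))))

  ≡0⇒∣ : ∀ {m x} → x ≡ + 0 [mod m ] → m ∣ x
  ≡0⇒∣ {x = x} (∣⇒≡-mod d) = ∣-resp-≡ (ℤP.+-identityʳ x) d

  mod²⇒mod : ∀ {m x y} → x ≡ y [mod m * m ] → x ≡ y [mod m ]
  mod²⇒mod {m} (∣⇒≡-mod (divides q eq)) = ∣⇒≡-mod (divides (q * m) (trans eq (sym (ℤP.*-assoc q m m))))

  *-pres-∣ : ∀ {m k x y} → m ∣ x → k ∣ y → m * k ∣ x * y
  *-pres-∣ {m} {k} (divides q refl) (divides r refl) = divides (q * r) (lemma q m r k)
    where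
    lemma : ∀ q m r k → q * m * (r * k) ≡ q * r * (m * k)
    lemma = solve-∀

  *-congˡ-mod² : ∀ {m e x y} → m ∣ e → x ≡ y [mod m ] → e * x ≡ e * y [mod m * m ]
  *-congˡ-mod² {m} {e} {x} {y} d (∣⇒≡-mod c) = ∣⇒≡-mod (∣-resp-≡ (lemma e x y) (*-pres-∣ d c))
    where
    lemma : ∀ e x y → e * (x - y) ≡ e * x - e * y
    lemma = solve-∀

module Combinatorics where

  open import Data.Nat as ℕ using (ℕ; zero; suc; _!)
  import Data.Nat.Properties as ℕP
  import Data.Nat.Divisibility as ℕD
  import Data.Nat.Tactic.RingSolver as ℕSolver
  open import Data.Integer as ℤ using (ℤ; +_; _+_; _*_; -_; _-_; -1ℤ)
  import Data.Integer.Properties as ℤP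
  open import Data.Integer.Tactic.RingSolver using (solve-∀)
  open import Relation.Binary.PropositionalEquality
  open import Data.Integer.Divisibility.Signed using (_∣_; divides; ∣-refl; ∣m∣n⇒∣m+n)
  open Congruence

  antiSum : ℕ → (ℕ → ℕ → ℤ) → ℤ
  antiSum zero    F = F 0 0
  antiSum (suc n) F = F 0 (suc n) + antiSum n (λ i j → F (suc i) j)

  antiSum-cong : ∀ n {F G : ℕ → ℕ → ℤ} → (∀ i j → i ℕ.+ j ≡ n → F i j ≡ G i j) →
                 antiSum n F ≡ antiSum n G
  antiSum-cong zero    e = e 0 0 refl
  antiSum-cong (suc n) e = cong₂ _+_ (e 0 (suc n) refl) (antiSum-cong n (λ i j eq → e (suc i) j (cong suc eq)))

  antiSum-cong-mod : ∀ {m} n {F G : ℕ → ℕ → ℤ} → (∀ i j → i ℕ.+ j ≡ n → F i j ≡ G i j [mod m ]) →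
                     antiSum n F ≡ antiSum n G [mod m ]
  antiSum-cong-mod zero    e = e 0 0 refl
  antiSum-cong-mod (suc n) e = +-cong (e 0 (suc n) refl) (antiSum-cong-mod n (λ i j eq → e (suc i) j (cong suc eq)))

  antiSum-∣ : ∀ {m} n {F : ℕ → ℕ → ℤ} → (∀ i j → i ℕ.+ j ≡ n → m ∣ F i j) → m ∣ antiSum n F
  antiSum-∣ zero    d = d 0 0 refl
  antiSum-∣ (suc n) d = ∣m∣n⇒∣m+n (d 0 (suc n) refl) (antiSum-∣ n (λ i j eq → d (suc i) j (cong suc eq)))

  antiSum-+ : ∀ n (F G : ℕ → ℕ → ℤ) → antiSum n (λ i j → F i j + G i j) ≡ antiSum n F + antiSum n G
  antiSum-+ zero    F G = refl
  antiSum-+ (suc n) F G = begin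
    F 0 (suc n) + G 0 (suc n) + antiSum n (λ i j → F (suc i) j + G (suc i) j)
      ≡⟨ cong (_+_ (F 0 (suc n) + G 0 (suc n))) (antiSum-+ n (λ i j → F (suc i) j) (λ i j → G (suc i) j)) ⟩
    F 0 (suc n) + G 0 (suc n) + (antiSum n (λ i j → F (suc i) j) + antiSum n (λ i j → G (suc i) j))
      ≡⟨ lemma (F 0 (suc n)) (G 0 (suc n)) _ _ ⟩
    F 0 (suc n) + antiSum n (λ i j → F (suc i) j) + (G 0 (suc n) + antiSum n (λ i j → G (suc i) j)) ∎
    where
    open ≡-Reasoning
    lemma : ∀ a b c d → a + b + (c + d) ≡ a + c + (b + d)
    lemma = solve-∀

  antiSum-*ˡ : ∀ n c (F : ℕ → ℕ → ℤ) → antiSum n (λ i j → c * F i j) ≡ c * antiSum n F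
  antiSum-*ˡ zero    c F = refl
  antiSum-*ˡ (suc n) c F = begin
    c * F 0 (suc n) + antiSum n (λ i j → c * F (suc i) j)
      ≡⟨ cong (_+_ (c * F 0 (suc n))) (antiSum-*ˡ n c (λ i j → F (suc i) j)) ⟩
    c * F 0 (suc n) + c * antiSum n (λ i j → F (suc i) j)
      ≡⟨ ℤP.*-distribˡ-+ c (F 0 (suc n)) _ ⟨
    c * (F 0 (suc n) + antiSum n (λ i j → F (suc i) j)) ∎
    where open ≡-Reasoning

  antiSum-last : ∀ n (F : ℕ → ℕ → ℤ) → antiSum (suc n) F ≡ antiSum n (λ i j → F i (suc j)) + F (suc n) 0
  antiSum-last zero    F = refl
  antiSum-last (suc n) F = begin
    F 0 (suc (suc n)) + antiSum (suc n) (λ i j → F (suc i) j)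
      ≡⟨ cong (_+_ (F 0 (suc (suc n)))) (antiSum-last n (λ i j → F (suc i) j)) ⟩
    F 0 (suc (suc n)) + (antiSum n (λ i j → F (suc i) (suc j)) + F (suc (suc n)) 0)
      ≡⟨ ℤP.+-assoc (F 0 (suc (suc n))) _ _ ⟨
    F 0 (suc (suc n)) + antiSum n (λ i j → F (suc i) (suc j)) + F (suc (suc n)) 0 ∎
    where open ≡-Reasoning

  -- binomial i j = C(i + j, i), so that Pascal's rule is structural recursion
  binomial : ℕ → ℕ → ℕ
  binomial zero    j       = 1
  binomial (suc i) zero    = 1
  binomial (suc i) (suc j) = binomial i (suc j) ℕ.+ binomial (suc i) j

  private
    binomial′ : ℕ → ℕ → ℤ
    binomial′ i zero    = + 0
    binomial′ i (suc j) = + binomial (suc i) j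

    binomial-split : ∀ i j → + binomial (suc i) j ≡ + binomial i j + binomial′ i j
    binomial-split zero    zero    = refl
    binomial-split (suc i) zero    = refl
    binomial-split zero    (suc j) = refl
    binomial-split (suc i) (suc j) = refl

  antiSum-pascal : ∀ n (h : ℕ → ℕ → ℤ) →
    antiSum (suc n) (λ i j → + binomial i j * h i j)
      ≡ antiSum n (λ i j → + binomial i j * h (suc i) j) + antiSum n (λ i j → + binomial i j * h i (suc j))
  antiSum-pascal zero    h = ℤP.+-comm (+ 1 * h 0 1) (+ 1 * h 1 0)
  antiSum-pascal (suc n) h = begin
    + 1 * h 0 (suc (suc n)) + antiSum (suc n) (λ i j → + binomial (suc i) j * h (suc i) j)
      ≡⟨ cong (_+_ (+ 1 * h 0 (suc (suc n)))) split ⟩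
    + 1 * h 0 (suc (suc n)) + (X + Y)
      ≡⟨ lemma (h 0 (suc (suc n))) X Y ⟩
    X + (+ 1 * h 0 (suc (suc n)) + Y) ∎
    where
    open ≡-Reasoning
    X = antiSum (suc n) (λ i j → + binomial i j * h (suc i) j)
    Y = antiSum n (λ i j → + binomial (suc i) j * h (suc i) (suc j))
    lemma : ∀ a x y → + 1 * a + (x + y) ≡ x + (+ 1 * a + y)
    lemma = solve-∀
    split : antiSum (suc n) (λ i j → + binomial (suc i) j * h (suc i) j) ≡ X + Y
    split = begin
      antiSum (suc n) (λ i j → + binomial (suc i) j * h (suc i) j)
        ≡⟨ antiSum-cong (suc n) (λ i j _ → trans (cong (_* h (suc i) j) (binomial-split i j))
                                                 (ℤP.*-distribʳ-+ (h (suc i) j) (+ binomial i j) (binomial′ i j))) ⟩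
      antiSum (suc n) (λ i j → + binomial i j * h (suc i) j + binomial′ i j * h (suc i) j)
        ≡⟨ antiSum-+ (suc n) (λ i j → + binomial i j * h (suc i) j) (λ i j → binomial′ i j * h (suc i) j) ⟩
      X + antiSum (suc n) (λ i j → binomial′ i j * h (suc i) j)
        ≡⟨ cong (_+_ X) (antiSum-last n (λ i j → binomial′ i j * h (suc i) j)) ⟩
      X + (Y + + 0 * h (suc (suc n)) 0)
        ≡⟨ cong (_+_ X) (ℤP.+-identityʳ Y) ⟩
      X + Y ∎

  binomial-factorial : ∀ i j → binomial i j ℕ.* (i ! ℕ.* j !) ≡ (i ℕ.+ j) !
  binomial-factorial zero    j       = trans (ℕP.+-identityʳ (1 ℕ.* j !)) (ℕP.*-identityˡ (j !))
  binomial-factorial (suc i) zero    = begin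
    1 ℕ.* (suc i ! ℕ.* 1) ≡⟨ trans (ℕP.*-identityˡ _) (ℕP.*-identityʳ _) ⟩
    suc i !               ≡⟨ cong _! (ℕP.+-identityʳ (suc i)) ⟨
    (suc i ℕ.+ 0) !       ∎
    where open ≡-Reasoning
  binomial-factorial (suc i) (suc j) = begin
    (binomial i (suc j) ℕ.+ binomial (suc i) j) ℕ.* (suc i ! ℕ.* suc j !)
      ≡⟨ lemma (binomial i (suc j)) (binomial (suc i) j) i j (i !) (j !) ⟩
    binomial i (suc j) ℕ.* (i ! ℕ.* suc j !) ℕ.* suc i ℕ.+ binomial (suc i) j ℕ.* (suc i ! ℕ.* j !) ℕ.* suc j
      ≡⟨ cong₂ (λ a b → a ℕ.* suc i ℕ.+ b ℕ.* suc j) (binomial-factorial i (suc j)) (binomial-factorial (suc i) j) ⟩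
    (i ℕ.+ suc j) ! ℕ.* suc i ℕ.+ (suc i ℕ.+ j) ! ℕ.* suc j
      ≡⟨ cong (λ k → k ! ℕ.* suc i ℕ.+ (suc i ℕ.+ j) ! ℕ.* suc j) (ℕP.+-suc i j) ⟩
    (suc i ℕ.+ j) ! ℕ.* suc i ℕ.+ (suc i ℕ.+ j) ! ℕ.* suc j
      ≡⟨ lemma′ i j ((suc i ℕ.+ j) !) ⟩
    suc (suc i ℕ.+ j) ℕ.* (suc i ℕ.+ j) !
      ≡⟨ cong (λ k → suc k ! ) (ℕP.+-suc i j) ⟨
    (suc (i ℕ.+ suc j)) ! ∎
    where
    open ≡-Reasoning
    lemma : ∀ a b i j x y → (a ℕ.+ b) ℕ.* ((suc i ℕ.* x) ℕ.* (suc j ℕ.* y))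
          ≡ a ℕ.* (x ℕ.* (suc j ℕ.* y)) ℕ.* suc i ℕ.+ b ℕ.* ((suc i ℕ.* x) ℕ.* y) ℕ.* suc j
    lemma = ℕSolver.solve-∀
    lemma′ : ∀ i j f → f ℕ.* suc i ℕ.+ f ℕ.* suc j ≡ suc (suc i ℕ.+ j) ℕ.* f
    lemma′ = ℕSolver.solve-∀

  binomial-absorption : ∀ i j → suc i ℕ.* binomial (suc i) j ≡ (suc i ℕ.+ j) ℕ.* binomial i j
  binomial-absorption i j = ℕP.*-cancelʳ-≡ _ _ (i ! ℕ.* j !) {{i ℕP.!* j !≢0}} (begin
    suc i ℕ.* binomial (suc i) j ℕ.* (i ! ℕ.* j !)   ≡⟨ lemma (suc i) (binomial (suc i) j) (i !) (j !) ⟩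
    binomial (suc i) j ℕ.* (suc i ! ℕ.* j !)         ≡⟨ binomial-factorial (suc i) j ⟩
    suc (i ℕ.+ j) ℕ.* (i ℕ.+ j) !                    ≡⟨ cong (suc (i ℕ.+ j) ℕ.*_) (binomial-factorial i j) ⟨
    suc (i ℕ.+ j) ℕ.* (binomial i j ℕ.* (i ! ℕ.* j !)) ≡⟨ ℕP.*-assoc (suc (i ℕ.+ j)) (binomial i j) (i ! ℕ.* j !) ⟨
    (suc i ℕ.+ j) ℕ.* binomial i j ℕ.* (i ! ℕ.* j !) ∎)
    where
    open ≡-Reasoning
    lemma : ∀ a b x y → a ℕ.* b ℕ.* (x ℕ.* y) ≡ b ℕ.* ((a ℕ.* x) ℕ.* y)
    lemma = ℕSolver.solve-∀

  -- y (y - c) ⋯ (y - (n - 1) c): powers for c = 0, falling factorials for c = 1, rising ones for c = -1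
  factorialPower : ℤ → ℤ → ℕ → ℤ
  factorialPower c y zero    = + 1
  factorialPower c y (suc n) = y * factorialPower c (y - c) n

  falling rising : ℤ → ℕ → ℤ
  falling = factorialPower (+ 1)
  rising  = factorialPower -1ℤ

  factorialPower-binomial : ∀ c n y z →
    factorialPower c (y + z) n ≡ antiSum n (λ i j → + binomial i j * (factorialPower c y i * factorialPower c z j))
  factorialPower-binomial c zero    y z = refl
  factorialPower-binomial c (suc n) y z = begin
    (y + z) * fp (y + z - c) n
      ≡⟨ ℤP.*-distribʳ-+ (fp (y + z - c) n) y z ⟩
    y * fp (y + z - c) n + z * fp (y + z - c) n
      ≡⟨ cong₂ (λ u v → y * fp u n + z * fp v n) (lemma₁ y z c) (lemma₂ y z c) ⟩
    y * fp ((y - c) + z) n + z * fp (y + (z - c)) n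
      ≡⟨ cong₂ (λ u v → y * u + z * v) (factorialPower-binomial c n (y - c) z) (factorialPower-binomial c n y (z - c)) ⟩
    y * antiSum n (λ i j → + binomial i j * (fp (y - c) i * fp z j))
      + z * antiSum n (λ i j → + binomial i j * (fp y i * fp (z - c) j))
      ≡⟨ cong₂ _+_ (antiSum-*ˡ n y (λ i j → + binomial i j * (fp (y - c) i * fp z j)))
                   (antiSum-*ˡ n z (λ i j → + binomial i j * (fp y i * fp (z - c) j))) ⟨
    antiSum n (λ i j → y * (+ binomial i j * (fp (y - c) i * fp z j)))
      + antiSum n (λ i j → z * (+ binomial i j * (fp y i * fp (z - c) j)))
      ≡⟨ cong₂ _+_ (antiSum-cong n (λ i j _ → lemma₃ y (+ binomial i j) (fp (y - c) i) (fp z j)))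
                   (antiSum-cong n (λ i j _ → lemma₄ z (+ binomial i j) (fp y i) (fp (z - c) j))) ⟩
    antiSum n (λ i j → + binomial i j * (fp y (suc i) * fp z j))
      + antiSum n (λ i j → + binomial i j * (fp y i * fp z (suc j)))
      ≡⟨ antiSum-pascal n (λ i j → fp y i * fp z j) ⟨
    antiSum (suc n) (λ i j → + binomial i j * (fp y i * fp z j)) ∎
    where
    open ≡-Reasoning
    fp = factorialPower c
    lemma₁ : ∀ y z c → y + z - c ≡ (y - c) + z
    lemma₁ = solve-∀
    lemma₂ : ∀ y z c → y + z - c ≡ y + (z - c)
    lemma₂ = solve-∀
    lemma₃ : ∀ y b u v → y * (b * (u * v)) ≡ b * ((y * u) * v)
    lemma₃ = solve-∀
    lemma₄ : ∀ z b u v → z * (b * (u * v)) ≡ b * (u * (z * v))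
    lemma₄ = solve-∀

  factorialPower-power : ∀ n y → factorialPower (+ 0) y n ≡ y ℤ.^ n
  factorialPower-power zero    y = refl
  factorialPower-power (suc n) y =
    cong (y *_) (trans (cong (λ u → factorialPower (+ 0) u n) (ℤP.+-identityʳ y)) (factorialPower-power n y))

  binomial-theorem : ∀ n y z → (y + z) ℤ.^ n ≡ antiSum n (λ i j → + binomial i j * (y ℤ.^ i * z ℤ.^ j))
  binomial-theorem n y z = begin
    (y + z) ℤ.^ n                  ≡⟨ factorialPower-power n (y + z) ⟨
    factorialPower (+ 0) (y + z) n ≡⟨ factorialPower-binomial (+ 0) n y z ⟩
    antiSum n (λ i j → + binomial i j * (factorialPower (+ 0) y i * factorialPower (+ 0) z j))
      ≡⟨ antiSum-cong n (λ i j _ → cong (+ binomial i j *_)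
                           (cong₂ _*_ (factorialPower-power i y) (factorialPower-power j z))) ⟩
    antiSum n (λ i j → + binomial i j * (y ℤ.^ i * z ℤ.^ j)) ∎
    where open ≡-Reasoning

  factorialPower-neg : ∀ c y n → factorialPower (- c) (- y) n ≡ -1ℤ ℤ.^ n * factorialPower c y n
  factorialPower-neg c y zero    = refl
  factorialPower-neg c y (suc n) = begin
    - y * factorialPower (- c) (- y - - c) n
      ≡⟨ cong (λ u → - y * factorialPower (- c) u n) (lemma₁ y c) ⟩
    - y * factorialPower (- c) (- (y - c)) n
      ≡⟨ cong (- y *_) (factorialPower-neg c (y - c) n) ⟩
    - y * (-1ℤ ℤ.^ n * factorialPower c (y - c) n)
      ≡⟨ lemma₂ y (-1ℤ ℤ.^ n) (factorialPower c (y - c) n) ⟩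
    -1ℤ * -1ℤ ℤ.^ n * (y * factorialPower c (y - c) n) ∎
    where
    open ≡-Reasoning
    lemma₁ : ∀ y c → - y - - c ≡ - (y - c)
    lemma₁ = solve-∀
    lemma₂ : ∀ y s f → - y * (s * f) ≡ -1ℤ * s * (y * f)
    lemma₂ = solve-∀

  factorialPower-suc : ∀ c y n → factorialPower c y (suc n) ≡ factorialPower c y n * (y - + n * c)
  factorialPower-suc c y zero    = lemma y c
    where
    lemma : ∀ y c → y * + 1 ≡ + 1 * (y - + 0 * c)
    lemma = solve-∀
  factorialPower-suc c y (suc n) = begin
    y * factorialPower c (y - c) (suc n)
      ≡⟨ cong (y *_) (factorialPower-suc c (y - c) n) ⟩
    y * (factorialPower c (y - c) n * (y - c - + n * c))
      ≡⟨ lemma y (factorialPower c (y - c) n) c (+ n) ⟩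
    y * factorialPower c (y - c) n * (y - (+ 1 + + n) * c)
      ≡⟨ cong (λ k → y * factorialPower c (y - c) n * (y - k * c)) (ℤP.pos-+ 1 n) ⟨
    y * factorialPower c (y - c) n * (y - + suc n * c) ∎
    where
    open ≡-Reasoning
    lemma : ∀ y f c n → y * (f * (y - c - n * c)) ≡ y * f * (y - (+ 1 + n) * c)
    lemma = solve-∀

  factorialPower-cong-mod : ∀ {m} c n {y z} → y ≡ z [mod m ] → factorialPower c y n ≡ factorialPower c z n [mod m ]
  factorialPower-cong-mod c zero    e = mod-refl
  factorialPower-cong-mod c (suc n) e = *-cong e (factorialPower-cong-mod c n (sub-cong e mod-refl))

  -1ℤ^n*-1ℤ^n≡1 : ∀ n → -1ℤ ℤ.^ n * -1ℤ ℤ.^ n ≡ + 1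
  -1ℤ^n*-1ℤ^n≡1 zero    = refl
  -1ℤ^n*-1ℤ^n≡1 (suc n) = trans (lemma (-1ℤ ℤ.^ n)) (-1ℤ^n*-1ℤ^n≡1 n)
    where
    lemma : ∀ s → -1ℤ * s * (-1ℤ * s) ≡ s * s
    lemma = solve-∀

  -1ℤ^even : ∀ {n} → 2 ℕD.∣ n → -1ℤ ℤ.^ n ≡ + 1
  -1ℤ^even (ℕD.divides q refl) =
    trans (sym (ℤP.^-*-assoc -1ℤ q 2)) (trans (cong (-1ℤ ℤ.^ q *_) (ℤP.*-identityʳ (-1ℤ ℤ.^ q))) (-1ℤ^n*-1ℤ^n≡1 q))

  rising-suc : ∀ y n → rising y (suc n) ≡ rising y n * (y + + n)
  rising-suc y n = trans (factorialPower-suc -1ℤ y n) (cong (rising y n *_) (lemma y (+ n)))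
    where
    lemma : ∀ y n → y - n * -1ℤ ≡ y + n
    lemma = solve-∀

  rising-one : ∀ k → rising (+ 1) k ≡ + (k !)
  rising-one zero    = refl
  rising-one (suc k) = begin
    rising (+ 1) (suc k)     ≡⟨ rising-suc (+ 1) k ⟩
    rising (+ 1) k * + suc k ≡⟨ cong (_* + suc k) (rising-one k) ⟩
    + (k !) * + suc k        ≡⟨ ℤP.*-comm (+ (k !)) (+ suc k) ⟩
    + suc k * + (k !)        ≡⟨ ℤP.pos-* (suc k) (k !) ⟨
    + (suc k !)              ∎
    where open ≡-Reasoning

  rising-neg : ∀ y n → rising (- y) n ≡ -1ℤ ℤ.^ n * falling y n
  rising-neg = factorialPower-neg (+ 1)

  falling-neg : ∀ y n → falling (- y) n ≡ -1ℤ ℤ.^ n * rising y n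
  falling-neg = factorialPower-neg -1ℤ

  falling-reverse : ∀ y n → falling (y + + n) n ≡ rising (y + + 1) n
  falling-reverse y zero    = refl
  falling-reverse y (suc n) = begin
    (y + + suc n) * falling (y + + suc n - + 1) n ≡⟨ cong (λ u → (y + + suc n) * falling u n) (lemma₁ y (+ n)) ⟩
    (y + + suc n) * falling (y + + n) n           ≡⟨ cong ((y + + suc n) *_) (falling-reverse y n) ⟩
    (y + + suc n) * rising (y + + 1) n            ≡⟨ lemma₂ y (+ n) (rising (y + + 1) n) ⟩
    rising (y + + 1) n * (y + + 1 + + n)          ≡⟨ rising-suc (y + + 1) n ⟨
    rising (y + + 1) (suc n)                      ∎
    where
    open ≡-Reasoning
    lemma₁ : ∀ y n → y + (+ 1 + n) - + 1 ≡ y + n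
    lemma₁ = solve-∀
    lemma₂ : ∀ y n f → (y + (+ 1 + n)) * f ≡ f * (y + + 1 + n)
    lemma₂ = solve-∀

  falling-beyond : ∀ m k → m ℕ.< k → falling (+ m) k ≡ + 0
  falling-beyond zero    (suc k) _ = ℤP.*-zeroˡ (falling -1ℤ k)
  falling-beyond (suc m) (suc k) (ℕ.s≤s m<k) = begin
    + suc m * falling (+ suc m - + 1) k ≡⟨ cong (λ u → + suc m * falling u k) (lemma (+ m)) ⟩
    + suc m * falling (+ m) k           ≡⟨ cong (+ suc m *_) (falling-beyond m k m<k) ⟩
    + suc m * + 0                       ≡⟨ ℤP.*-zeroʳ (+ suc m) ⟩
    + 0                                 ∎
    where
    open ≡-Reasoning
    lemma : ∀ m → + 1 + m - + 1 ≡ m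
    lemma = solve-∀

  falling-factorial : ∀ i j → falling (+ (i ℕ.+ j)) i * + (j !) ≡ + ((i ℕ.+ j) !)
  falling-factorial zero    j = ℤP.*-identityˡ (+ (j !))
  falling-factorial (suc i) j = begin
    + suc (i ℕ.+ j) * falling (+ suc (i ℕ.+ j) - + 1) i * + (j !)
      ≡⟨ cong (λ u → + suc (i ℕ.+ j) * falling u i * + (j !)) (lemma (+ (i ℕ.+ j))) ⟩
    + suc (i ℕ.+ j) * falling (+ (i ℕ.+ j)) i * + (j !)
      ≡⟨ ℤP.*-assoc (+ suc (i ℕ.+ j)) (falling (+ (i ℕ.+ j)) i) (+ (j !)) ⟩
    + suc (i ℕ.+ j) * (falling (+ (i ℕ.+ j)) i * + (j !))
      ≡⟨ cong (+ suc (i ℕ.+ j) *_) (falling-factorial i j) ⟩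
    + suc (i ℕ.+ j) * + ((i ℕ.+ j) !)
      ≡⟨ ℤP.pos-* (suc (i ℕ.+ j)) ((i ℕ.+ j) !) ⟨
    + (suc (i ℕ.+ j) !) ∎
    where
    open ≡-Reasoning
    lemma : ∀ m → + 1 + m - + 1 ≡ m
    lemma = solve-∀

  -- the n-th forward difference of t ↦ t ^ m at x
  diffPow : ℕ → ℤ → ℕ → ℤ
  diffPow n x m = antiSum n (λ i j → + binomial i j * (-1ℤ ℤ.^ j * (x + + i) ℤ.^ m))

  diffPow-zero : ∀ n x → diffPow (suc n) x 0 ≡ + 0
  diffPow-zero n x = begin
    diffPow (suc n) x 0
      ≡⟨ antiSum-cong (suc n) (λ i j _ → cong (+ binomial i j *_)
           (trans (ℤP.*-identityʳ (-1ℤ ℤ.^ j))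
                  (trans (sym (ℤP.*-identityˡ (-1ℤ ℤ.^ j))) (cong (_* -1ℤ ℤ.^ j) (sym (ℤP.^-zeroˡ i)))))) ⟩
    antiSum (suc n) (λ i j → + binomial i j * ((+ 1) ℤ.^ i * -1ℤ ℤ.^ j))
      ≡⟨ binomial-theorem (suc n) (+ 1) -1ℤ ⟨
    (+ 1 + -1ℤ) ℤ.^ suc n
      ≡⟨ ℤP.*-zeroˡ ((+ 1 + -1ℤ) ℤ.^ n) ⟩
    + 0 ∎
    where open ≡-Reasoning

  private
    antiSum-absorption : ∀ n (H : ℕ → ℤ) →
      antiSum (suc n) (λ i j → + binomial i j * (-1ℤ ℤ.^ j * (+ i * H i)))
        ≡ + suc n * antiSum n (λ i j → + binomial i j * (-1ℤ ℤ.^ j * H (suc i)))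
    antiSum-absorption n H = begin
      + 1 * (-1ℤ ℤ.^ suc n * (+ 0 * H 0)) + antiSum n (λ i j → + binomial (suc i) j * (-1ℤ ℤ.^ j * (+ suc i * H (suc i))))
        ≡⟨ cong₂ _+_ (lemma₁ (-1ℤ ℤ.^ suc n) (H 0)) (antiSum-cong n absorb) ⟩
      + 0 + antiSum n (λ i j → + suc n * (+ binomial i j * (-1ℤ ℤ.^ j * H (suc i))))
        ≡⟨ ℤP.+-identityˡ _ ⟩
      antiSum n (λ i j → + suc n * (+ binomial i j * (-1ℤ ℤ.^ j * H (suc i))))
        ≡⟨ antiSum-*ˡ n (+ suc n) (λ i j → + binomial i j * (-1ℤ ℤ.^ j * H (suc i))) ⟩
      + suc n * antiSum n (λ i j → + binomial i j * (-1ℤ ℤ.^ j * H (suc i))) ∎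
      where
      open ≡-Reasoning
      lemma₁ : ∀ s h → + 1 * (s * (+ 0 * h)) ≡ + 0
      lemma₁ = solve-∀
      lemma₂ : ∀ b s i h → b * (s * (i * h)) ≡ (i * b) * (s * h)
      lemma₂ = solve-∀
      absorb : ∀ i j → i ℕ.+ j ≡ n →
        + binomial (suc i) j * (-1ℤ ℤ.^ j * (+ suc i * H (suc i))) ≡ + suc n * (+ binomial i j * (-1ℤ ℤ.^ j * H (suc i)))
      absorb i j refl = begin
        + binomial (suc i) j * (-1ℤ ℤ.^ j * (+ suc i * H (suc i)))
          ≡⟨ lemma₂ (+ binomial (suc i) j) (-1ℤ ℤ.^ j) (+ suc i) (H (suc i)) ⟩
        (+ suc i * + binomial (suc i) j) * (-1ℤ ℤ.^ j * H (suc i))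
          ≡⟨ cong (_* (-1ℤ ℤ.^ j * H (suc i))) (begin
               + suc i * + binomial (suc i) j    ≡⟨ ℤP.pos-* (suc i) (binomial (suc i) j) ⟨
               + (suc i ℕ.* binomial (suc i) j)  ≡⟨ cong +_ (binomial-absorption i j) ⟩
               + (suc (i ℕ.+ j) ℕ.* binomial i j) ≡⟨ ℤP.pos-* (suc (i ℕ.+ j)) (binomial i j) ⟩
               + suc (i ℕ.+ j) * + binomial i j  ∎) ⟩
        (+ suc (i ℕ.+ j) * + binomial i j) * (-1ℤ ℤ.^ j * H (suc i))
          ≡⟨ ℤP.*-assoc (+ suc (i ℕ.+ j)) (+ binomial i j) (-1ℤ ℤ.^ j * H (suc i)) ⟩
        + suc (i ℕ.+ j) * (+ binomial i j * (-1ℤ ℤ.^ j * H (suc i))) ∎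

  diffPow-suc : ∀ n x m → diffPow (suc n) x (suc m) ≡ x * diffPow (suc n) x m + + suc n * diffPow n (x + + 1) m
  diffPow-suc n x m = begin
    antiSum (suc n) (λ i j → + binomial i j * (-1ℤ ℤ.^ j * ((x + + i) * (x + + i) ℤ.^ m)))
      ≡⟨ antiSum-cong (suc n) (λ i j _ → lemma (+ binomial i j) (-1ℤ ℤ.^ j) x (+ i) ((x + + i) ℤ.^ m)) ⟩
    antiSum (suc n) (λ i j → x * (+ binomial i j * (-1ℤ ℤ.^ j * (x + + i) ℤ.^ m))
                             + + binomial i j * (-1ℤ ℤ.^ j * (+ i * (x + + i) ℤ.^ m)))
      ≡⟨ antiSum-+ (suc n) (λ i j → x * (+ binomial i j * (-1ℤ ℤ.^ j * (x + + i) ℤ.^ m)))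
                           (λ i j → + binomial i j * (-1ℤ ℤ.^ j * (+ i * (x + + i) ℤ.^ m))) ⟩
    antiSum (suc n) (λ i j → x * (+ binomial i j * (-1ℤ ℤ.^ j * (x + + i) ℤ.^ m)))
      + antiSum (suc n) (λ i j → + binomial i j * (-1ℤ ℤ.^ j * (+ i * (x + + i) ℤ.^ m)))
      ≡⟨ cong₂ _+_ (antiSum-*ˡ (suc n) x (λ i j → + binomial i j * (-1ℤ ℤ.^ j * (x + + i) ℤ.^ m)))
                   (antiSum-absorption n (λ i → (x + + i) ℤ.^ m)) ⟩
    x * diffPow (suc n) x m + + suc n * antiSum n (λ i j → + binomial i j * (-1ℤ ℤ.^ j * (x + + suc i) ℤ.^ m))
      ≡⟨ cong (λ s → x * diffPow (suc n) x m + + suc n * s)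
              (antiSum-cong n (λ i j _ → cong (λ u → + binomial i j * (-1ℤ ℤ.^ j * u ℤ.^ m)) (lemma′ x i))) ⟩
    x * diffPow (suc n) x m + + suc n * diffPow n (x + + 1) m ∎
    where
    open ≡-Reasoning
    lemma : ∀ b s x i y → b * (s * ((x + i) * y)) ≡ x * (b * (s * y)) + b * (s * (i * y))
    lemma = solve-∀
    lemma′ : ∀ x i → x + + suc i ≡ x + + 1 + + i
    lemma′ x i = trans (cong (_+_ x) (ℤP.pos-+ 1 i)) (sym (ℤP.+-assoc x (+ 1) (+ i)))

  diffPow-below : ∀ m n x → m ℕ.< n → diffPow n x m ≡ + 0
  diffPow-below zero    (suc n)       x _ = diffPow-zero n x
  diffPow-below (suc m) (suc (suc n)) x (ℕ.s≤s m<n) = begin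
    diffPow (suc (suc n)) x (suc m)
      ≡⟨ diffPow-suc (suc n) x m ⟩
    x * diffPow (suc (suc n)) x m + + suc (suc n) * diffPow (suc n) (x + + 1) m
      ≡⟨ cong₂ (λ u v → x * u + + suc (suc n) * v)
               (diffPow-below m (suc (suc n)) x (ℕP.m<n⇒m<1+n m<n)) (diffPow-below m (suc n) (x + + 1) m<n) ⟩
    x * + 0 + + suc (suc n) * + 0
      ≡⟨ lemma x (+ suc (suc n)) ⟩
    + 0 ∎
    where
    open ≡-Reasoning
    lemma : ∀ a b → a * + 0 + b * + 0 ≡ + 0
    lemma = solve-∀

  diffPow-diagonal : ∀ n x → diffPow n x n ≡ + (n !)
  diffPow-diagonal zero    x = refl
  diffPow-diagonal (suc n) x = begin
    diffPow (suc n) x (suc n)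
      ≡⟨ diffPow-suc n x n ⟩
    x * diffPow (suc n) x n + + suc n * diffPow n (x + + 1) n
      ≡⟨ cong₂ (λ u v → x * u + + suc n * v) (diffPow-below n (suc n) x (ℕP.n<1+n n)) (diffPow-diagonal n (x + + 1)) ⟩
    x * + 0 + + suc n * + (n !)
      ≡⟨ lemma x (+ suc n) (+ (n !)) ⟩
    + suc n * + (n !)
      ≡⟨ ℤP.pos-* (suc n) (n !) ⟨
    + (suc n !) ∎
    where
    open ≡-Reasoning
    lemma : ∀ x a b → x * + 0 + a * b ≡ a * b
    lemma = solve-∀

  ∑≤ : ℕ → (ℕ → ℤ) → ℤ
  ∑≤ zero    f = f 0
  ∑≤ (suc n) f = ∑≤ n f + f (suc n)

  ∏< : ℕ → (ℕ → ℤ) → ℤ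
  ∏< zero    f = + 1
  ∏< (suc n) f = f 0 * ∏< n (λ i → f (suc i))

  ∑≤-cong : ∀ n {f g : ℕ → ℤ} → (∀ k → k ℕ.≤ n → f k ≡ g k) → ∑≤ n f ≡ ∑≤ n g
  ∑≤-cong zero    e = e 0 ℕ.z≤n
  ∑≤-cong (suc n) e = cong₂ _+_ (∑≤-cong n (λ k k≤n → e k (ℕP.m≤n⇒m≤1+n k≤n))) (e (suc n) ℕP.≤-refl)

  ∑≤-cong-mod : ∀ {m} n {f g : ℕ → ℤ} → (∀ k → k ℕ.≤ n → f k ≡ g k [mod m ]) → ∑≤ n f ≡ ∑≤ n g [mod m ]
  ∑≤-cong-mod zero    e = e 0 ℕ.z≤n
  ∑≤-cong-mod (suc n) e = +-cong (∑≤-cong-mod n (λ k k≤n → e k (ℕP.m≤n⇒m≤1+n k≤n))) (e (suc n) ℕP.≤-refl)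

  ∑≤-distrib-+- : ∀ n (f g h : ℕ → ℤ) → ∑≤ n (λ k → f k + g k - h k) ≡ ∑≤ n f + ∑≤ n g - ∑≤ n h
  ∑≤-distrib-+- zero    f g h = refl
  ∑≤-distrib-+- (suc n) f g h = begin
    ∑≤ n (λ k → f k + g k - h k) + (f (suc n) + g (suc n) - h (suc n))
      ≡⟨ cong (_+ (f (suc n) + g (suc n) - h (suc n))) (∑≤-distrib-+- n f g h) ⟩
    ∑≤ n f + ∑≤ n g - ∑≤ n h + (f (suc n) + g (suc n) - h (suc n))
      ≡⟨ lemma (∑≤ n f) (∑≤ n g) (∑≤ n h) (f (suc n)) (g (suc n)) (h (suc n)) ⟩
    ∑≤ n f + f (suc n) + (∑≤ n g + g (suc n)) - (∑≤ n h + h (suc n)) ∎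
    where
    open ≡-Reasoning
    lemma : ∀ a b c x y z → a + b - c + (x + y - z) ≡ a + x + (b + y) - (c + z)
    lemma = solve-∀

  ∑≤-*ʳ : ∀ n (f : ℕ → ℤ) c → ∑≤ n (λ k → f k * c) ≡ ∑≤ n f * c
  ∑≤-*ʳ zero    f c = refl
  ∑≤-*ʳ (suc n) f c = trans (cong (_+ f (suc n) * c) (∑≤-*ʳ n f c)) (sym (ℤP.*-distribʳ-+ c (∑≤ n f) (f (suc n))))

  ∑≤-vanishing-tail : ∀ {n N} (f : ℕ → ℤ) → (∀ k → n ℕ.< k → f k ≡ + 0) → n ℕ.≤ N → ∑≤ N f ≡ ∑≤ n f
  ∑≤-vanishing-tail {n} f vanish n≤N =
    trans (cong (λ N → ∑≤ N f) (sym (ℕP.m+[n∸m]≡n n≤N))) (extend _)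
    where
    open ≡-Reasoning
    extend : ∀ t → ∑≤ (n ℕ.+ t) f ≡ ∑≤ n f
    extend zero    = cong (λ N → ∑≤ N f) (ℕP.+-identityʳ n)
    extend (suc t) = begin
      ∑≤ (n ℕ.+ suc t) f                ≡⟨ cong (λ N → ∑≤ N f) (ℕP.+-suc n t) ⟩
      ∑≤ (n ℕ.+ t) f + f (suc (n ℕ.+ t)) ≡⟨ cong₂ _+_ (extend t) (vanish (suc (n ℕ.+ t)) (ℕ.s≤s (ℕP.m≤m+n n t))) ⟩
      ∑≤ n f + + 0                      ≡⟨ ℤP.+-identityʳ (∑≤ n f) ⟩
      ∑≤ n f                            ∎

  antiSum-∑≤ : ∀ n (F : ℕ → ℕ → ℤ) → antiSum n F ≡ ∑≤ n (λ i → F i (n ℕ.∸ i))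
  antiSum-∑≤ zero    F = refl
  antiSum-∑≤ (suc n) F = begin
    antiSum (suc n) F
      ≡⟨ antiSum-last n F ⟩
    antiSum n (λ i j → F i (suc j)) + F (suc n) 0
      ≡⟨ cong₂ _+_ (antiSum-∑≤ n (λ i j → F i (suc j))) (cong (F (suc n)) (sym (ℕP.n∸n≡0 n))) ⟩
    ∑≤ n (λ i → F i (suc (n ℕ.∸ i))) + F (suc n) (n ℕ.∸ n)
      ≡⟨ cong (_+ F (suc n) (n ℕ.∸ n)) (∑≤-cong n (λ k k≤n → cong (F k) (sym (ℕP.+-∸-assoc 1 k≤n)))) ⟩
    ∑≤ n (λ i → F i (suc n ℕ.∸ i)) + F (suc n) (n ℕ.∸ n) ∎
    where open ≡-Reasoning

  ∏<-cong : ∀ n {f g : ℕ → ℤ} → (∀ k → k ℕ.< n → f k ≡ g k) → ∏< n f ≡ ∏< n g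
  ∏<-cong zero    e = refl
  ∏<-cong (suc n) e = cong₂ _*_ (e 0 (ℕ.s≤s ℕ.z≤n)) (∏<-cong n (λ k k<n → e (suc k) (ℕ.s≤s k<n)))

  ∏<-cong-mod : ∀ {m} n {f g : ℕ → ℤ} → (∀ k → k ℕ.< n → f k ≡ g k [mod m ]) → ∏< n f ≡ ∏< n g [mod m ]
  ∏<-cong-mod zero    e = mod-refl
  ∏<-cong-mod (suc n) e = *-cong (e 0 (ℕ.s≤s ℕ.z≤n)) (∏<-cong-mod n (λ k k<n → e (suc k) (ℕ.s≤s k<n)))

  ∏<-+ : ∀ a b (f : ℕ → ℤ) → ∏< (a ℕ.+ b) f ≡ ∏< a f * ∏< b (λ i → f (a ℕ.+ i))
  ∏<-+ zero    b f = sym (ℤP.*-identityˡ (∏< b f))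
  ∏<-+ (suc a) b f = begin
    f 0 * ∏< (a ℕ.+ b) (λ i → f (suc i))
      ≡⟨ cong (f 0 *_) (∏<-+ a b (λ i → f (suc i))) ⟩
    f 0 * (∏< a (λ i → f (suc i)) * ∏< b (λ i → f (suc a ℕ.+ i)))
      ≡⟨ ℤP.*-assoc (f 0) (∏< a (λ i → f (suc i))) (∏< b (λ i → f (suc a ℕ.+ i))) ⟨
    f 0 * ∏< a (λ i → f (suc i)) * ∏< b (λ i → f (suc a ℕ.+ i)) ∎
    where open ≡-Reasoning

  ∏<-* : ∀ n (f g : ℕ → ℤ) → ∏< n (λ i → f i * g i) ≡ ∏< n f * ∏< n g
  ∏<-* zero    f g = refl
  ∏<-* (suc n) f g = begin
    f 0 * g 0 * ∏< n (λ i → f (suc i) * g (suc i))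
      ≡⟨ cong (f 0 * g 0 *_) (∏<-* n (λ i → f (suc i)) (λ i → g (suc i))) ⟩
    f 0 * g 0 * (∏< n (λ i → f (suc i)) * ∏< n (λ i → g (suc i)))
      ≡⟨ lemma (f 0) (g 0) (∏< n (λ i → f (suc i))) (∏< n (λ i → g (suc i))) ⟩
    f 0 * ∏< n (λ i → f (suc i)) * (g 0 * ∏< n (λ i → g (suc i))) ∎
    where
    open ≡-Reasoning
    lemma : ∀ a b c d → a * b * (c * d) ≡ a * c * (b * d)
    lemma = solve-∀

  ∏<-one : ∀ n {f : ℕ → ℤ} → (∀ k → k ℕ.< n → f k ≡ + 1) → ∏< n f ≡ + 1
  ∏<-one zero    e = refl
  ∏<-one (suc n) e = trans (cong₂ _*_ (e 0 (ℕ.s≤s ℕ.z≤n)) (∏<-one n (λ k k<n → e (suc k) (ℕ.s≤s k<n))))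
                           (ℤP.*-identityˡ (+ 1))

  rising-∏< : ∀ y n → rising y n ≡ ∏< n (λ i → y + + i)
  rising-∏< y zero    = refl
  rising-∏< y (suc n) = begin
    y * rising (y + + 1) n               ≡⟨ cong₂ _*_ (sym (ℤP.+-identityʳ y)) (rising-∏< (y + + 1) n) ⟩
    (y + + 0) * ∏< n (λ i → y + + 1 + + i) ≡⟨ cong ((y + + 0) *_) (∏<-cong n (λ i _ → lemma y i)) ⟩
    (y + + 0) * ∏< n (λ i → y + + suc i) ∎
    where
    open ≡-Reasoning
    lemma : ∀ y i → y + + 1 + + i ≡ y + + suc i
    lemma y i = trans (ℤP.+-assoc y (+ 1) (+ i)) (cong (_+_ y) (sym (ℤP.pos-+ 1 i)))

  -- the first-order terms of the two products cancel
  ∏<-± : ∀ m n (f : ℕ → ℤ) → ∏< n (λ i → f i + m) + ∏< n (λ i → f i - m) ≡ + 2 * ∏< n f [mod m * m ]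
  ∏<-± m zero    f = mod-refl
  ∏<-± m (suc n) f = begin
    (f 0 + m) * A + (f 0 - m) * B    ≡⟨ lemma (f 0) m A B ⟩
    f 0 * (A + B) + (m * A - m * B)  ≈⟨ +-cong (*-congˡ (f 0) (∏<-± m n (λ i → f (suc i))))
                                               (sub-cong (*-congˡ-mod² ∣-refl A≡B) (mod-refl {x = m * B})) ⟩
    f 0 * (+ 2 * Q) + (m * B - m * B) ≡⟨ lemma′ (f 0) Q (m * B) ⟩
    + 2 * (f 0 * Q)                  ∎
    where
    open ModReasoning (m * m)
    A B Q : ℤ
    A = ∏< n (λ i → f (suc i) + m)
    B = ∏< n (λ i → f (suc i) - m)
    Q = ∏< n (λ i → f (suc i))
    m≡-m : m ≡ - m [mod m ]
    m≡-m = ∣⇒≡-mod (divides (+ 2) (lemma₀ m))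
      where
      lemma₀ : ∀ m → m - - m ≡ + 2 * m
      lemma₀ = solve-∀
    A≡B : A ≡ B [mod m ]
    A≡B = ∏<-cong-mod n (λ i _ → +-congˡ (f (suc i)) m≡-m)
    lemma : ∀ f m A B → (f + m) * A + (f - m) * B ≡ f * (A + B) + (m * A - m * B)
    lemma = solve-∀
    lemma′ : ∀ f Q x → f * (+ 2 * Q) + (x - x) ≡ + 2 * (f * Q)
    lemma′ = solve-∀

module ModuloPrime (r : ℕ) (p-prime : Prime (suc (suc r))) where

  open import Data.Nat as ℕ using (ℕ; zero; suc; _!)
  open import Data.Nat.Primality using (euclidsLemma; prime⇒irreducible)
  import Data.Nat.Properties as ℕP
  import Data.Nat.Divisibility as ℕD
  open import Data.Integer as ℤ using (ℤ; +_; _+_; _*_; -_; _-_; -1ℤ)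
  import Data.Integer.Properties as ℤP
  import Data.Integer.Divisibility as Unsigned
  open import Data.Integer.Divisibility.Signed
  open import Data.Integer.DivMod using (_%ℕ_)
  open import Data.Integer.Tactic.RingSolver using (solve-∀)
  open import Data.Sum as Sum using (_⊎_; inj₁; inj₂)
  open import Data.Empty using (⊥-elim)
  open import Relation.Nullary using (¬_)
  open import Relation.Binary.PropositionalEquality
  open import Defs using (modN)
  open Congruence
  open Combinatorics

  p : ℕ
  p = suc (suc r)

  P : ℤ
  P = + p

  euclidsLemma-ℤ : ∀ a b → P ∣ a * b → P ∣ a ⊎ P ∣ b
  euclidsLemma-ℤ a b d =
    Sum.map ∣ᵤ⇒∣ ∣ᵤ⇒∣ (euclidsLemma ℤ.∣ a ∣ ℤ.∣ b ∣ p-prime (subst (p ℕD.∣_) (ℤP.abs-* a b) (∣⇒∣ᵤ d)))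

  P∤* : ∀ {a b} → ¬ P ∣ a → ¬ P ∣ b → ¬ P ∣ a * b
  P∤* {a} {b} a-unit b-unit d = Sum.[ a-unit , b-unit ]′ (euclidsLemma-ℤ a b d)

  P∤small : ∀ {k} → 0 ℕ.< k → k ℕ.< p → ¬ P ∣ + k
  P∤small 0<k k<p d = ℕP.<⇒≱ k<p (ℕD.∣⇒≤ {{ℕ.>-nonZero 0<k}} (∣⇒∣ᵤ d))

  p∤! : ∀ {k} → k ℕ.< p → ¬ p ℕD.∣ k !
  p∤! {zero}  _ d with ℕD.∣1⇒≡1 d
  ... | ()
  p∤! {suc k} (ℕ.s≤s k<p-1) d with euclidsLemma (suc k) (k !) p-prime d
  ... | inj₁ p∣k+1 = ℕP.<⇒≱ (ℕ.s≤s k<p-1) (ℕD.∣⇒≤ p∣k+1)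
  ... | inj₂ p∣k!  = p∤! (ℕP.m<n⇒m<1+n k<p-1) p∣k!

  P∤! : ∀ {k} → k ℕ.< p → ¬ P ∣ + (k !)
  P∤! k<p d = p∤! k<p (∣⇒∣ᵤ d)

  p∣binomial : ∀ i j → suc i ℕ.+ suc j ≡ p → p ℕD.∣ binomial (suc i) (suc j)
  p∣binomial i j eq with euclidsLemma (binomial (suc i) (suc j)) (suc i ! ℕ.* suc j !) p-prime
                           (subst (p ℕD.∣_) (sym (trans (binomial-factorial (suc i) (suc j)) (cong _! eq)))
                                  (ℕD.m∣m*n {p} ((suc r) !)))
  ... | inj₁ p∣C = p∣C
  ... | inj₂ p∣i!j! = ⊥-elim (Sum.[ p∤! i<p , p∤! j<p ]′ (euclidsLemma (suc i !) (suc j !) p-prime p∣i!j!))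
    where
    i<p : suc i ℕ.< p
    i<p = subst (suc i ℕ.<_) eq (ℕP.m<m+n (suc i) (ℕ.s≤s ℕ.z≤n))
    j<p : suc j ℕ.< p
    j<p = subst (suc j ℕ.<_) eq (ℕP.m<n+m (suc j) (ℕ.s≤s ℕ.z≤n))

  frobenius-+ : ∀ y z → (y + z) ℤ.^ p ≡ y ℤ.^ p + z ℤ.^ p [mod P ]
  frobenius-+ y z = begin
    (y + z) ℤ.^ p                                                 ≡⟨ binomial-theorem p y z ⟩
    F 0 p + antiSum (suc r) (λ i j → F (suc i) j)                 ≡⟨ cong (_+_ (F 0 p)) (antiSum-last r (λ i j → F (suc i) j)) ⟩
    F 0 p + (antiSum r (λ i j → F (suc i) (suc j)) + F p 0)       ≈⟨ +-congˡ (F 0 p) (+-congʳ (F p 0) middle) ⟩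
    F 0 p + (+ 0 + F p 0)                                         ≡⟨ lemma (y ℤ.^ p) (z ℤ.^ p) ⟩
    y ℤ.^ p + z ℤ.^ p                                             ∎
    where
    open ModReasoning P
    F : ℕ → ℕ → ℤ
    F i j = + binomial i j * (y ℤ.^ i * z ℤ.^ j)
    middle : antiSum r (λ i j → F (suc i) (suc j)) ≡ + 0 [mod P ]
    middle = ∣⇒≡0 (antiSum-∣ r P∣F)
      where
      P∣F : ∀ i j → i ℕ.+ j ≡ r → P ∣ F (suc i) (suc j)
      P∣F i j eq = ∣m⇒∣m*n {m = + binomial (suc i) (suc j)} (y ℤ.^ suc i * z ℤ.^ suc j)
                     (∣ᵤ⇒∣ (p∣binomial i j (cong suc (trans (ℕP.+-suc i j) (cong suc eq)))))
    lemma : ∀ Y Z → + 1 * (+ 1 * Z) + (+ 0 + + 1 * (Y * + 1)) ≡ Y + Z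
    lemma = solve-∀

  fermat : ∀ x → x ℤ.^ p ≡ x [mod P ]
  fermat x = mod-trans (^-cong p (%ℕ-residue x p)) (mod-trans (fermat-ℕ (x %ℕ p)) (mod-sym (%ℕ-residue x p)))
    where
    fermat-ℕ : ∀ n → (+ n) ℤ.^ p ≡ + n [mod P ]
    fermat-ℕ zero    = mod-reflexive (ℤP.*-zeroˡ ((+ 0) ℤ.^ suc r))
    fermat-ℕ (suc n) = mod-trans (frobenius-+ (+ 1) (+ n))
                                 (+-cong (mod-reflexive (ℤP.^-zeroˡ p)) (fermat-ℕ n))

  fermat-unit : ∀ {x} → ¬ P ∣ x → x ℤ.^ (p ℕ.∸ 1) ≡ + 1 [mod P ]
  fermat-unit {x} x-unit = ∣⇒≡-mod (Sum.[ (λ P∣x → ⊥-elim (x-unit P∣x)) , (λ d → d) ]′ (euclidsLemma-ℤ x (y - + 1) P∣x[y-1]))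
    where
    y : ℤ
    y = x ℤ.^ (p ℕ.∸ 1)
    lemma : ∀ x y → x * y - x ≡ x * (y - + 1)
    lemma = solve-∀
    P∣x[y-1] : P ∣ x * (y - + 1)
    P∣x[y-1] = ∣-resp-≡ (lemma x y) (≡-mod⇒∣ (fermat x))

  -- (1 + c n)^k ≡ 1 + k c n (mod n²)
  pow-lift : ∀ n {y} → y ≡ + 1 [mod + n ] → y ℤ.^ n ≡ + 1 [mod + n * + n ]
  pow-lift n {y} (∣⇒≡-mod (divides c y-1≡cn)) = begin
    y ℤ.^ n                  ≡⟨ cong (ℤ._^ n) y≡ ⟩
    (+ 1 + c * + n) ℤ.^ n    ≈⟨ expand n ⟩
    + 1 + + n * c * + n      ≈⟨ ∣⇒≡-mod (divides c (lemma₃ (+ n) c)) ⟩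
    + 1                      ∎
    where
    open ModReasoning (+ n * + n)
    lemma₁ : ∀ y → y ≡ + 1 + (y - + 1)
    lemma₁ = solve-∀
    y≡ : y ≡ + 1 + c * + n
    y≡ = trans (lemma₁ y) (cong (_+_ (+ 1)) y-1≡cn)
    lemma₂ : ∀ k c n → (+ 1 + c * n) * (+ 1 + k * c * n) - (+ 1 + (+ 1 + k) * c * n) ≡ k * c * c * (n * n)
    lemma₂ = solve-∀
    lemma₃ : ∀ n c → + 1 + n * c * n - + 1 ≡ c * (n * n)
    lemma₃ = solve-∀
    expand : ∀ k → (+ 1 + c * + n) ℤ.^ k ≡ + 1 + + k * c * + n [mod + n * + n ]
    expand zero    = mod-reflexive (lemma₀ c (+ n))
      where
      lemma₀ : ∀ c n → + 1 ≡ + 1 + + 0 * c * n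
      lemma₀ = solve-∀
    expand (suc k) = mod-trans (*-congˡ (+ 1 + c * + n) (expand k)) (∣⇒≡-mod (divides (+ k * c * c) (lemma₂ (+ k) c (+ n))))

  invExp : ℕ
  invExp = p ℕ.^ 1 ℕ.* (p ℕ.∸ 1) ℕ.∸ 1

  -- Euler's theorem modulo p², as suc invExp = (p - 1) p
  inverse-mod-P² : ∀ {x} → ¬ P ∣ x → x * x ℤ.^ invExp ≡ + 1 [mod P * P ]
  inverse-mod-P² {x} x-unit = begin
    x ℤ.^ suc invExp                ≡⟨ cong (x ℤ.^_) exponent ⟩
    x ℤ.^ ((p ℕ.∸ 1) ℕ.* p)         ≡⟨ ℤP.^-*-assoc x (p ℕ.∸ 1) p ⟨
    (x ℤ.^ (p ℕ.∸ 1)) ℤ.^ p         ≈⟨ pow-lift p (fermat-unit x-unit) ⟩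
    + 1                             ∎
    where
    open ModReasoning (P * P)
    exponent : suc invExp ≡ (p ℕ.∸ 1) ℕ.* p
    exponent = trans (ℕP.suc-pred (p ℕ.^ 1 ℕ.* suc r) {{ℕP.m*n≢0 (p ℕ.^ 1) (suc r) {{ℕP.m^n≢0 p 1}}}})
                     (trans (cong (ℕ._* suc r) (ℕP.*-identityʳ p)) (ℕP.*-comm p (suc r)))

  cancel-mod-P : ∀ {a b u} → ¬ P ∣ u → a * u ≡ b * u [mod P ] → a ≡ b [mod P ]
  cancel-mod-P {a} {b} {u} u-unit (∣⇒≡-mod d) =
    ∣⇒≡-mod (Sum.[ (λ e → e) , (λ P∣u → ⊥-elim (u-unit P∣u)) ]′ (euclidsLemma-ℤ (a - b) u (∣-resp-≡ (lemma a b u) d)))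
    where
    lemma : ∀ a b u → a * u - b * u ≡ (a - b) * u
    lemma = solve-∀

  cancel-mod-P² : ∀ {a b u} → ¬ P ∣ u → a * u ≡ b * u [mod P * P ] → a ≡ b [mod P * P ]
  cancel-mod-P² {a} {b} {u} u-unit au≡bu = begin
    a                        ≡⟨ ℤP.*-identityʳ a ⟨
    a * + 1                  ≈⟨ *-congˡ a (mod-sym (inverse-mod-P² u-unit)) ⟩
    a * (u * u ℤ.^ invExp)   ≡⟨ ℤP.*-assoc a u (u ℤ.^ invExp) ⟨
    a * u * u ℤ.^ invExp     ≈⟨ *-congʳ (u ℤ.^ invExp) au≡bu ⟩
    b * u * u ℤ.^ invExp     ≡⟨ ℤP.*-assoc b u (u ℤ.^ invExp) ⟩
    b * (u * u ℤ.^ invExp)   ≈⟨ *-congˡ b (inverse-mod-P² u-unit) ⟩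
    b * + 1                  ≡⟨ ℤP.*-identityʳ b ⟩
    b                        ∎
    where open ModReasoning (P * P)

  -- (p-1)! is the (p-1)-st difference of t ↦ t^(p-1) at 0, and by Fermat t^(p-1) ≡ t^0 for 0 < t < p.
  wilson : + ((p ℕ.∸ 1) !) ≡ - (-1ℤ ℤ.^ (p ℕ.∸ 1)) [mod P ]
  wilson = begin
    + (suc r !)                                      ≡⟨ diffPow-diagonal (suc r) (+ 0) ⟨
    F 0 (suc r) + antiSum r (λ i j → F (suc i) j)    ≡⟨ cong (_+ antiSum r (λ i j → F (suc i) j)) F₀≡0 ⟩
    + 0 + antiSum r (λ i j → F (suc i) j)            ≈⟨ +-congˡ (+ 0) (antiSum-cong-mod r F≡G) ⟩
    + 0 + antiSum r (λ i j → G (suc i) j)            ≡⟨ lemma (G 0 (suc r)) (antiSum r (λ i j → G (suc i) j)) (diffPow-zero r (+ 0)) ⟩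
    - G 0 (suc r)                                    ≡⟨ cong -_ (lemma′ (-1ℤ ℤ.^ suc r)) ⟩
    - (-1ℤ ℤ.^ suc r)                                ∎
    where
    open ModReasoning P
    F G : ℕ → ℕ → ℤ
    F i j = + binomial i j * (-1ℤ ℤ.^ j * (+ i) ℤ.^ (p ℕ.∸ 1))
    G i j = + binomial i j * (-1ℤ ℤ.^ j * + 1)
    F₀≡0 : F 0 (suc r) ≡ + 0
    F₀≡0 = lemma₀ (-1ℤ ℤ.^ suc r) ((+ 0) ℤ.^ r)
      where
      lemma₀ : ∀ s z → + 1 * (s * (+ 0 * z)) ≡ + 0
      lemma₀ = solve-∀
    F≡G : ∀ i j → i ℕ.+ j ≡ r → F (suc i) j ≡ G (suc i) j [mod P ]
    F≡G i j eq = *-congˡ (+ binomial (suc i) j) (*-congˡ (-1ℤ ℤ.^ j) (fermat-unit (P∤small (ℕ.s≤s ℕ.z≤n) i<p)))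
      where
      i<p : suc i ℕ.< p
      i<p = ℕ.s≤s (ℕ.s≤s (subst (i ℕ.≤_) eq (ℕP.m≤m+n i j)))
    lemma : ∀ g t → g + t ≡ + 0 → + 0 + t ≡ - g
    lemma g t e = trans (lemma₀ g t) (trans (cong (_- g) e) (ℤP.+-identityˡ (- g)))
      where
      lemma₀ : ∀ g t → + 0 + t ≡ g + t - g
      lemma₀ = solve-∀
    lemma′ : ∀ s → + 1 * (s * + 1) ≡ s
    lemma′ = solve-∀

  private
    even-or-odd : ∀ n → 2 ℕD.∣ n ⊎ 2 ℕD.∣ suc n
    even-or-odd zero    = inj₁ (ℕD.divides 0 refl)
    even-or-odd (suc n) with even-or-odd n
    ... | inj₁ 2∣n   = inj₂ (subst (2 ℕD.∣_) (ℕP.+-comm n 2) (ℕD.∣m∣n⇒∣m+n 2∣n (ℕD.∣-refl {2})))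
    ... | inj₂ 2∣n+1 = inj₁ 2∣n+1

  -1ℤ^[p-1]≡1 : p ≢ 2 → -1ℤ ℤ.^ (p ℕ.∸ 1) ≡ + 1
  -1ℤ^[p-1]≡1 p≢2 with even-or-odd (suc r)
  ... | inj₁ 2∣p-1 = -1ℤ^even 2∣p-1
  ... | inj₂ 2∣p with prime⇒irreducible p-prime 2∣p
  ...   | inj₁ ()
  ...   | inj₂ 2≡p = ⊥-elim (p≢2 (sym 2≡p))

  P*P≡p² : P * P ≡ + (p ℕ.^ 2)
  P*P≡p² = trans (sym (ℤP.pos-* p p)) (cong (λ k → + (p ℕ.* k)) (sym (ℕP.*-identityʳ p)))

  residue-P² : ∀ x → + modN x (p ℕ.^ 2) ≡ x [mod P * P ]
  residue-P² x = subst (λ m → + modN x (p ℕ.^ 2) ≡ x [mod m ]) (sym P*P≡p²) (mod-sym (%ℕ-residue x (p ℕ.^ 2)))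

  mod-P²⇒modp² : ∀ {x y} → x ≡ y [mod P * P ] → + (p ℕ.^ 2) Unsigned.∣ x - y
  mod-P²⇒modp² {x} {y} d = subst (ℕD._∣ ℤ.∣ x - y ∣) (cong ℤ.∣_∣ P*P≡p²) (∣⇒∣ᵤ (≡-mod⇒∣ d))

module Hypergeometric (r : ℕ) (p-prime : Prime (suc (suc r))) where

  open import Data.Nat as ℕ using (ℕ; zero; suc; _!)
  import Data.Nat.Properties as ℕP
  open import Data.Integer as ℤ using (ℤ; +_; _+_; _*_; -_; _-_; -1ℤ)
  import Data.Integer.Properties as ℤP
  open import Data.Integer.Divisibility.Signed using (∣m⇒∣m*n)
  open import Data.Integer.Tactic.RingSolver using (solve-∀)
  open import Relation.Binary.PropositionalEquality
  open import Defs using (poch; cst; ₂F₁-trunc)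
  open Congruence
  open Combinatorics
  open ModuloPrime r p-prime

  -- k!⁻¹ modulo p² (for k < p), computed as in Defs.inv
  I : ℕ → ℤ
  I k = (+ (k !)) ℤ.^ invExp

  factorial-inverse : ∀ {k} → k ℕ.< p → + (k !) * I k ≡ + 1 [mod P * P ]
  factorial-inverse k<p = inverse-mod-P² (P∤! k<p)

  hgTerm : ℤ → ℤ → ℕ → ℤ
  hgTerm a b k = rising a k * rising b k * I k * I k

  hgSum : ℤ → ℤ → ℕ → ℤ
  hgSum a b n = ∑≤ n (hgTerm a b)

  hgSum-comm : ∀ a b n → hgSum a b n ≡ hgSum b a n
  hgSum-comm a b n = ∑≤-cong n (λ k _ → cong (λ u → u * I k * I k) (ℤP.*-comm (rising a k) (rising b k)))

  -- (a)_k (b)_k - (a)_k (-B)_k - (-A)_k (b)_k + (-A)_k (-B)_k factors as a product of two multiples of p.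
  hgSum-split : ∀ {a b} A B n → a ≡ - + A [mod P ] → b ≡ - + B [mod P ] →
    hgSum a b n ≡ hgSum a (- + B) n + hgSum (- + A) b n - hgSum (- + A) (- + B) n [mod P * P ]
  hgSum-split {a} {b} A B n a≡-A b≡-B = mod-trans
    (∑≤-cong-mod n (λ k _ → term-split k))
    (mod-reflexive (∑≤-distrib-+- n (hgTerm a (- + B)) (hgTerm (- + A) b) (hgTerm (- + A) (- + B))))
    where
    lemma : ∀ a a₀ b b₀ J → a * b * J * J - (a * b₀ * J * J + a₀ * b * J * J - a₀ * b₀ * J * J)
                           ≡ (a - a₀) * (b - b₀) * (J * J)
    lemma = solve-∀
    term-split : ∀ k → hgTerm a b k ≡ hgTerm a (- + B) k + hgTerm (- + A) b k - hgTerm (- + A) (- + B) k [mod P * P ]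
    term-split k = ∣⇒≡-mod (∣-resp-≡ (sym (lemma (rising a k) (rising (- + A) k) (rising b k) (rising (- + B) k) (I k)))
      (∣m⇒∣m*n (I k * I k) (*-pres-∣ (≡-mod⇒∣ (factorialPower-cong-mod -1ℤ k a≡-A)) (≡-mod⇒∣ (factorialPower-cong-mod -1ℤ k b≡-B)))))

  -- both sides are (n!)² / j!, where n = i + j
  falling-binomial : ∀ i j → falling (+ (i ℕ.+ j)) i * + ((i ℕ.+ j) !)
                           ≡ + binomial i j * falling (+ (i ℕ.+ j)) j * + (i !) * + (i !)
  falling-binomial i j = ℤP.*-cancelʳ-≡ _ _ (+ (j !)) {{j ℕP.!≢0}} (begin
    falling (+ n) i * + (n !) * + (j !)   ≡⟨ lemma₁ (falling (+ n) i) (+ (n !)) (+ (j !)) ⟩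
    falling (+ n) i * + (j !) * + (n !)   ≡⟨ cong (_* + (n !)) (falling-factorial i j) ⟩
    + (n !) * + (n !)
      ≡⟨ cong₂ _*_ C-factorial (sym (subst (λ m → falling (+ m) j * + (i !) ≡ + (m !)) (ℕP.+-comm j i) (falling-factorial j i))) ⟩
    + binomial i j * (+ (i !) * + (j !)) * (falling (+ n) j * + (i !))
                                      ≡⟨ lemma₂ (+ binomial i j) (+ (i !)) (+ (j !)) (falling (+ n) j) ⟩
    + binomial i j * falling (+ n) j * + (i !) * + (i !) * + (j !) ∎)
    where
    open ≡-Reasoning
    n = i ℕ.+ j
    C-factorial : + ((i ℕ.+ j) !) ≡ + binomial i j * (+ (i !) * + (j !))
    C-factorial = begin
      + ((i ℕ.+ j) !)                           ≡⟨ cong +_ (binomial-factorial i j) ⟨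
      + (binomial i j ℕ.* (i ! ℕ.* j !))        ≡⟨ ℤP.pos-* (binomial i j) (i ! ℕ.* j !) ⟩
      + binomial i j * + (i ! ℕ.* j !)          ≡⟨ cong (+ binomial i j *_) (ℤP.pos-* (i !) (j !)) ⟩
      + binomial i j * (+ (i !) * + (j !))      ∎
    lemma₁ : ∀ a b c → a * b * c ≡ a * c * b
    lemma₁ = solve-∀
    lemma₂ : ∀ b x y f → b * (x * y) * (f * x) ≡ b * f * x * x * y
    lemma₂ = solve-∀

  hgTerm-neg : ∀ x {n} i j → i ℕ.+ j ≡ n → n ℕ.< p →
    hgTerm x (- + n) i * + (n !) ≡ + binomial i j * (falling (- x) i * falling (+ n) j) [mod P * P ]
  hgTerm-neg x i j refl n<p = begin
    R * rising (- + n) i * Iᵢ * Iᵢ * + (n !)      ≡⟨ cong (λ u → R * u * Iᵢ * Iᵢ * + (n !)) (rising-neg (+ n) i) ⟩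
    R * (s * F) * Iᵢ * Iᵢ * + (n !)               ≡⟨ lemma₁ R s F Iᵢ (+ (n !)) ⟩
    s * R * (F * + (n !)) * Iᵢ * Iᵢ               ≡⟨ cong (λ u → s * R * u * Iᵢ * Iᵢ) (falling-binomial i j) ⟩
    s * R * (C * G * f * f) * Iᵢ * Iᵢ             ≡⟨ lemma₂ s R C G f Iᵢ ⟩
    C * (s * R) * G * ((f * Iᵢ) * (f * Iᵢ))       ≈⟨ *-congˡ (C * (s * R) * G) (*-cong f*Iᵢ≡1 f*Iᵢ≡1) ⟩
    C * (s * R) * G * (+ 1 * + 1)               ≡⟨ lemma₃ C (s * R) G ⟩
    C * ((s * R) * G)                           ≡⟨ cong (λ u → C * (u * G)) (falling-neg x i) ⟨
    C * (falling (- x) i * G)                   ∎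
    where
    open ModReasoning (P * P)
    n = i ℕ.+ j
    R = rising x i
    s = -1ℤ ℤ.^ i
    F = falling (+ n) i
    G = falling (+ n) j
    C = + binomial i j
    Iᵢ = I i
    f = + (i !)
    f*Iᵢ≡1 : f * Iᵢ ≡ + 1 [mod P * P ]
    f*Iᵢ≡1 = factorial-inverse (ℕP.≤-<-trans (ℕP.m≤m+n i j) n<p)
    lemma₁ : ∀ R s F Iᵢ N → R * (s * F) * Iᵢ * Iᵢ * N ≡ s * R * (F * N) * Iᵢ * Iᵢ
    lemma₁ = solve-∀
    lemma₂ : ∀ s R C G f Iᵢ → s * R * (C * G * f * f) * Iᵢ * Iᵢ ≡ C * (s * R) * G * ((f * Iᵢ) * (f * Iᵢ))
    lemma₂ = solve-∀
    lemma₃ : ∀ C a G → C * a * G * (+ 1 * + 1) ≡ C * (a * G)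
    lemma₃ = solve-∀

  hgTerm-beyond : ∀ x {B k} → B ℕ.< k → hgTerm x (- + B) k ≡ + 0
  hgTerm-beyond x {B} {k} B<k = begin
    rising x k * rising (- + B) k * I k * I k             ≡⟨ cong (λ u → rising x k * u * I k * I k) (rising-neg (+ B) k) ⟩
    rising x k * (-1ℤ ℤ.^ k * falling (+ B) k) * I k * I k
      ≡⟨ cong (λ u → rising x k * (-1ℤ ℤ.^ k * u) * I k * I k) (falling-beyond B k B<k) ⟩
    rising x k * (-1ℤ ℤ.^ k * + 0) * I k * I k             ≡⟨ lemma (rising x k) (-1ℤ ℤ.^ k) (I k) ⟩
    + 0                                                    ∎
    where
    open ≡-Reasoning
    lemma : ∀ a s J → a * (s * + 0) * J * J ≡ + 0
    lemma = solve-∀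

  chu-vandermonde : ∀ x {B N} → B ℕ.≤ N → B ℕ.< p → hgSum x (- + B) N ≡ rising (+ 1 - x) B * I B [mod P * P ]
  chu-vandermonde x {B} {N} B≤N B<p = begin
    hgSum x (- + B) N                          ≡⟨ ∑≤-vanishing-tail (hgTerm x (- + B)) (λ k → hgTerm-beyond x) B≤N ⟩
    hgSum x (- + B) B                          ≡⟨ ℤP.*-identityʳ (hgSum x (- + B) B) ⟨
    hgSum x (- + B) B * + 1                    ≈⟨ *-congˡ (hgSum x (- + B) B) (mod-sym (factorial-inverse B<p)) ⟩
    hgSum x (- + B) B * (+ (B !) * I B)        ≡⟨ ℤP.*-assoc (hgSum x (- + B) B) (+ (B !)) (I B) ⟨
    hgSum x (- + B) B * + (B !) * I B          ≈⟨ *-congʳ (I B) exact ⟩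
    rising (+ 1 - x) B * I B                   ∎
    where
    open ModReasoning (P * P)
    exact : hgSum x (- + B) B * + (B !) ≡ rising (+ 1 - x) B [mod P * P ]
    exact = begin
      hgSum x (- + B) B * + (B !)                       ≡⟨ ∑≤-*ʳ B (hgTerm x (- + B)) (+ (B !)) ⟨
      ∑≤ B (λ k → hgTerm x (- + B) k * + (B !))
        ≈⟨ ∑≤-cong-mod B (λ k k≤B → hgTerm-neg x k (B ℕ.∸ k) (ℕP.m+[n∸m]≡n k≤B) B<p) ⟩
      ∑≤ B (λ k → V k (B ℕ.∸ k))                         ≡⟨ antiSum-∑≤ B V ⟨
      antiSum B V                                       ≡⟨ factorialPower-binomial (+ 1) B (- x) (+ B) ⟨
      falling (- x + + B) B                             ≡⟨ falling-reverse (- x) B ⟩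
      rising (- x + + 1) B                              ≡⟨ cong (λ u → rising u B) (ℤP.+-comm (- x) (+ 1)) ⟩
      rising (+ 1 - x) B                                ∎
      where
      V : ℕ → ℕ → ℤ
      V i j = + binomial i j * (falling (- x) i * falling (+ B) j)

  poch-rising : ∀ x k n → poch x k n ≡ rising (x n) k
  poch-rising x zero    n = refl
  poch-rising x (suc k) n = trans (cong (_* (x n + + k)) (poch-rising x k n)) (sym (rising-suc (x n) k))

  ₂F₁-trunc≡hgSum : ∀ a b K → ₂F₁-trunc p a b K 2 ≡ hgSum (a 2) (b 2) K
  ₂F₁-trunc≡hgSum a b zero    = refl
  ₂F₁-trunc≡hgSum a b (suc k) = cong₂ _+_ (₂F₁-trunc≡hgSum a b k) (cong₂ (λ x y → x * y * I (suc k))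
    (cong₂ _*_ (poch-rising a (suc k) 2) (poch-rising b (suc k) 2))
    (cong (ℤ._^ invExp) (trans (poch-rising (cst (+ 1)) (suc k) 2) (rising-one (suc k)))))

module MoritaGamma (r : ℕ) (p-prime : Prime (suc (suc r))) where

  open import Data.Nat as ℕ using (ℕ; zero; suc; _!)
  import Data.Nat.Properties as ℕP
  import Data.Nat.Divisibility as ℕD
  open import Data.Integer as ℤ using (ℤ; +_; -[1+_]; _+_; _*_; -_; _-_; -1ℤ)
  import Data.Integer.Properties as ℤP
  open import Data.Integer.Divisibility.Signed using (_∣_; divides; quotient; ∣-refl; ∣⇒∣ᵤ; ∣ᵤ⇒∣; ∣m⇒∣m*n; ∣n⇒∣m*n)
  open import Data.Integer.Tactic.RingSolver using (solve-∀)
  open import Data.Bool using (Bool; true; false; not; if_then_else_)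
  open import Data.List using (foldr; filterᵇ; map; applyUpTo)
  open import Data.Empty using (⊥-elim)
  open import Relation.Nullary using (¬_; yes; no)
  open import Relation.Binary.PropositionalEquality
  open import Defs using (ΓpN; modN)
  open Congruence
  open Combinatorics
  open ModuloPrime r p-prime

  Γ : ℕ → ℤ
  Γ = ΓpN p

  unit? : ℕ → Bool
  unit? j = not (modN (+ j) p ℕ.≡ᵇ 0)

  unitPart multiplePart : ℕ → ℕ
  unitPart     j = if unit? j then j else 1
  multiplePart j = if unit? j then 1 else j

  unitPart*multiplePart : ∀ j → unitPart j ℕ.* multiplePart j ≡ j
  unitPart*multiplePart j with unit? j
  ... | true  = ℕP.*-identityʳ j
  ... | false = ℕP.*-identityˡ j

  p∣⇒¬unit : ∀ {j} → p ℕD.∣ j → unit? j ≡ false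
  p∣⇒¬unit {j} p∣j rewrite ℕD.n∣m⇒m%n≡0 j p p∣j = refl

  p∤⇒unit : ∀ {j} → ¬ p ℕD.∣ j → unit? j ≡ true
  p∤⇒unit {j} p∤j with j ℕ.% p in eq
  ... | zero  = ⊥-elim (p∤j (ℕD.m%n≡0⇒n∣m j p eq))
  ... | suc _ = refl

  unitPart-∣ : ∀ {j} → p ℕD.∣ j → unitPart j ≡ 1
  unitPart-∣ p∣j rewrite p∣⇒¬unit p∣j = refl

  unitPart-∤ : ∀ {j} → ¬ p ℕD.∣ j → unitPart j ≡ j
  unitPart-∤ p∤j rewrite p∤⇒unit p∤j = refl

  multiplePart-∣ : ∀ {j} → p ℕD.∣ j → multiplePart j ≡ j
  multiplePart-∣ p∣j rewrite p∣⇒¬unit p∣j = refl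

  multiplePart-∤ : ∀ {j} → ¬ p ℕD.∣ j → multiplePart j ≡ 1
  multiplePart-∤ p∤j rewrite p∤⇒unit p∤j = refl

  P∤unitPart : ∀ j → ¬ P ∣ + unitPart j
  P∤unitPart j with p ℕD.∣? j
  ... | yes p∣j rewrite unitPart-∣ p∣j = P∤small (ℕ.s≤s ℕ.z≤n) (ℕ.s≤s (ℕ.s≤s ℕ.z≤n))
  ... | no  p∤j rewrite unitPart-∤ p∤j = λ P∣j → p∤j (∣⇒∣ᵤ P∣j)

  multiples : ℕ → ℕ → ℤ
  multiples n m = ∏< m (λ i → + multiplePart (n ℕ.+ i))

  private
    filtered-product : ∀ f m → + foldr ℕ._*_ 1 (filterᵇ unit? (map suc (applyUpTo f m)))
                                ≡ ∏< m (λ i → + unitPart (suc (f i)))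
    filtered-product f zero    = refl
    filtered-product f (suc m) with unit? (suc (f 0))
    ... | true  = trans (ℤP.pos-* (suc (f 0)) _) (cong (+ suc (f 0) *_) (filtered-product (λ i → f (suc i)) m))
    ... | false = trans (filtered-product (λ i → f (suc i)) m) (sym (ℤP.*-identityˡ _))

  Γ-product : ∀ n → Γ n ≡ -1ℤ ℤ.^ n * ∏< n (λ j → + unitPart j)
  Γ-product zero    = refl
  Γ-product (suc n) = cong (-1ℤ ℤ.^ suc n *_) (trans (filtered-product (λ i → i) n) (sym (ℤP.*-identityˡ _)))

  Γ-window : ∀ n m → Γ (n ℕ.+ m) ≡ -1ℤ ℤ.^ m * ∏< m (λ i → + unitPart (n ℕ.+ i)) * Γ n
  Γ-window n m = begin
    Γ (n ℕ.+ m)                                       ≡⟨ Γ-product (n ℕ.+ m) ⟩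
    -1ℤ ℤ.^ (n ℕ.+ m) * ∏< (n ℕ.+ m) u                ≡⟨ cong₂ _*_ (ℤP.^-distribˡ-+-* -1ℤ n m) (∏<-+ n m u) ⟩
    -1ℤ ℤ.^ n * -1ℤ ℤ.^ m * (∏< n u * ∏< m (λ i → u (n ℕ.+ i)))
                                                      ≡⟨ lemma (-1ℤ ℤ.^ n) (-1ℤ ℤ.^ m) (∏< n u) (∏< m (λ i → u (n ℕ.+ i))) ⟩
    -1ℤ ℤ.^ m * ∏< m (λ i → u (n ℕ.+ i)) * (-1ℤ ℤ.^ n * ∏< n u)
                                                      ≡⟨ cong (-1ℤ ℤ.^ m * ∏< m (λ i → u (n ℕ.+ i)) *_) (Γ-product n) ⟨
    -1ℤ ℤ.^ m * ∏< m (λ i → u (n ℕ.+ i)) * Γ n        ∎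
    where
    open ≡-Reasoning
    u : ℕ → ℤ
    u j = + unitPart j
    lemma : ∀ a b c d → a * b * (c * d) ≡ b * d * (a * c)
    lemma = solve-∀

  Γ-rising : ∀ n m → multiples n m * Γ (n ℕ.+ m) ≡ -1ℤ ℤ.^ m * rising (+ n) m * Γ n
  Γ-rising n m = begin
    M * Γ (n ℕ.+ m)                   ≡⟨ cong (M *_) (Γ-window n m) ⟩
    M * (-1ℤ ℤ.^ m * U * Γ n)         ≡⟨ lemma M (-1ℤ ℤ.^ m) U (Γ n) ⟩
    -1ℤ ℤ.^ m * (U * M) * Γ n         ≡⟨ cong (λ x → -1ℤ ℤ.^ m * x * Γ n) U*M≡rising ⟩
    -1ℤ ℤ.^ m * rising (+ n) m * Γ n  ∎
    where
    open ≡-Reasoning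
    U M : ℤ
    U = ∏< m (λ i → + unitPart (n ℕ.+ i))
    M = multiples n m
    lemma : ∀ M s U G → M * (s * U * G) ≡ s * (U * M) * G
    lemma = solve-∀
    U*M≡rising : U * M ≡ rising (+ n) m
    U*M≡rising = begin
      U * M
        ≡⟨ ∏<-* m (λ i → + unitPart (n ℕ.+ i)) (λ i → + multiplePart (n ℕ.+ i)) ⟨
      ∏< m (λ i → + unitPart (n ℕ.+ i) * + multiplePart (n ℕ.+ i))  ≡⟨ ∏<-cong m (λ i _ → factor i) ⟩
      ∏< m (λ i → + n + + i)                                         ≡⟨ rising-∏< (+ n) m ⟨
      rising (+ n) m                                                 ∎
      where
      factor : ∀ i → + unitPart (n ℕ.+ i) * + multiplePart (n ℕ.+ i) ≡ + n + + i
      factor i = trans (sym (ℤP.pos-* (unitPart (n ℕ.+ i)) (multiplePart (n ℕ.+ i))))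
                       (trans (cong +_ (unitPart*multiplePart (n ℕ.+ i))) (ℤP.pos-+ n i))

  P∤∏< : ∀ n {f : ℕ → ℤ} → (∀ k → ¬ P ∣ f k) → ¬ P ∣ ∏< n f
  P∤∏< zero    units = P∤small (ℕ.s≤s ℕ.z≤n) (ℕ.s≤s (ℕ.s≤s ℕ.z≤n))
  P∤∏< (suc n) units = P∤* (units 0) (P∤∏< n (λ k → units (suc k)))

  P∤-1^ : ∀ n → ¬ P ∣ -1ℤ ℤ.^ n
  P∤-1^ n P∣s = P∤small (ℕ.s≤s ℕ.z≤n) (ℕ.s≤s (ℕ.s≤s ℕ.z≤n))
    (subst (P ∣_) (-1ℤ^n*-1ℤ^n≡1 n) (∣m⇒∣m*n (-1ℤ ℤ.^ n) P∣s))

  P∤Γ : ∀ n → ¬ P ∣ Γ n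
  P∤Γ n rewrite Γ-product n = P∤* (P∤-1^ n) (P∤∏< n (λ k → P∤unitPart k))

  window : ℕ → ℤ
  window x = ∏< p (λ i → + unitPart (x ℕ.+ i))

  window-suc : ∀ x → window (suc x) * + unitPart x ≡ window x * + unitPart (x ℕ.+ p)
  window-suc x = begin
    window (suc x) * u x                             ≡⟨ ℤP.*-comm (window (suc x)) (u x) ⟩
    u x * window (suc x)
      ≡⟨ cong₂ _*_ (cong u (ℕP.+-identityʳ x)) (∏<-cong p (λ i _ → cong u (ℕP.+-suc x i))) ⟨
    ∏< (suc p) (λ i → u (x ℕ.+ i))                   ≡⟨ cong (λ n → ∏< n (λ i → u (x ℕ.+ i))) (ℕP.+-comm p 1) ⟨
    ∏< (p ℕ.+ 1) (λ i → u (x ℕ.+ i))                 ≡⟨ ∏<-+ p 1 (λ i → u (x ℕ.+ i)) ⟩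
    window x * (u (x ℕ.+ (p ℕ.+ 0)) * + 1)
      ≡⟨ cong (window x *_) (trans (ℤP.*-identityʳ _) (cong (λ k → u (x ℕ.+ k)) (ℕP.+-identityʳ p))) ⟩
    window x * u (x ℕ.+ p)                           ∎
    where
    open ≡-Reasoning
    u : ℕ → ℤ
    u j = + unitPart j

  factorial-∏< : ∀ n → ∏< n (λ i → + suc i) ≡ + (n !)
  factorial-∏< n = trans (sym (rising-∏< (+ 1) n)) (rising-one n)

  window-zero : window 0 ≡ + ((p ℕ.∸ 1) !)
  window-zero = begin
    + 1 * ∏< (suc r) (λ i → + unitPart (suc i))  ≡⟨ ℤP.*-identityˡ _ ⟩
    ∏< (suc r) (λ i → + unitPart (suc i))        ≡⟨ ∏<-cong (suc r) (λ i i<p-1 → cong +_ (unitPart-∤ (small i<p-1))) ⟩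
    ∏< (suc r) (λ i → + suc i)                   ≡⟨ factorial-∏< (suc r) ⟩
    + (suc r !)                                  ∎
    where
    open ≡-Reasoning
    small : ∀ {i} → i ℕ.< suc r → ¬ p ℕD.∣ suc i
    small i<p-1 p∣i+1 = ℕP.<⇒≱ (ℕ.s≤s i<p-1) (ℕD.∣⇒≤ p∣i+1)

  p∣+p : ∀ {j} → p ℕD.∣ j → p ℕD.∣ j ℕ.+ p
  p∣+p p∣j = ℕD.∣m∣n⇒∣m+n p∣j (ℕD.∣-refl {p})

  p∤+p : ∀ {j} → ¬ p ℕD.∣ j → ¬ p ℕD.∣ j ℕ.+ p
  p∤+p {j} p∤j p∣j+p = p∤j (ℕD.∣m+n∣m⇒∣n (subst (p ℕD.∣_) (ℕP.+-comm j p) p∣j+p) (ℕD.∣-refl {p}))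

  unitPart-+p : ∀ x → + unitPart (x ℕ.+ p) ≡ + unitPart x [mod P ]
  unitPart-+p x with p ℕD.∣? x
  ... | yes p∣x rewrite unitPart-∣ p∣x | unitPart-∣ (p∣+p p∣x) = mod-refl
  ... | no  p∤x rewrite unitPart-∤ p∤x | unitPart-∤ (p∤+p p∤x) =
    ∣⇒≡-mod (divides (+ 1) (trans (cong (_- + x) (ℤP.pos-+ x p)) (lemma (+ x) P)))
    where
    lemma : ∀ x P → x + P - x ≡ + 1 * P
    lemma = solve-∀

  window-mod-P : ∀ x → window x ≡ + ((p ℕ.∸ 1) !) [mod P ]
  window-mod-P zero    = mod-reflexive window-zero
  window-mod-P (suc x) = mod-trans (cancel-mod-P (P∤unitPart x) (begin
    window (suc x) * + unitPart x         ≡⟨ window-suc x ⟩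
    window x * + unitPart (x ℕ.+ p)       ≈⟨ *-congˡ (window x) (unitPart-+p x) ⟩
    window x * + unitPart x               ∎)) (window-mod-P x)
    where open ModReasoning P

  shift-by-p : ∀ x k → x ℕ.+ suc k ℕ.* p ≡ x ℕ.+ k ℕ.* p ℕ.+ p
  shift-by-p x k = trans (cong (x ℕ.+_) (ℕP.+-comm p (k ℕ.* p))) (sym (ℕP.+-assoc x (k ℕ.* p) p))

  p∤-residue : ∀ {n c} → + n ≡ + suc c [mod P ] → suc c ℕ.< p → ¬ p ℕD.∣ n
  p∤-residue n≡c+1 c+1<p p∣n =
    P∤small (ℕ.s≤s ℕ.z≤n) c+1<p (≡0⇒∣ (mod-trans (mod-sym n≡c+1) (∣⇒≡0 (∣ᵤ⇒∣ p∣n))))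

  p∣-residue : ∀ {n} → + n ≡ P [mod P ] → p ℕD.∣ n
  p∣-residue n≡p = ∣⇒∣ᵤ (≡0⇒∣ (mod-trans n≡p (∣⇒≡0 ∣-refl)))

  multiples-none : ∀ {n c} m → + n ≡ + suc c [mod P ] → c ℕ.+ m ℕ.< p → multiples n m ≡ + 1
  multiples-none {n} {c} m n≡c+1 c+m<p = ∏<-one m (λ i i<m → cong +_ (multiplePart-∤ (p∤-residue (pos-+-cong-mod i n≡c+1) (small i<m))))
    where
    small : ∀ {i} → i ℕ.< m → suc (c ℕ.+ i) ℕ.< p
    small i<m = ℕP.<-≤-trans (ℕ.s≤s (ℕP.+-monoʳ-< c i<m)) c+m<p

  multiples-one : ∀ {n c j} t → + n ≡ + suc c [mod P ] → c ℕ.+ j ≡ p ℕ.∸ 1 → t ℕ.< p ℕ.∸ 1 →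
                  multiples n (j ℕ.+ suc t) ≡ + (n ℕ.+ j)
  multiples-one {n} {c} {j} t n≡c+1 c+j≡p-1 t<p-1 = begin
    multiples n (j ℕ.+ suc t)                         ≡⟨ ∏<-+ j (suc t) f ⟩
    multiples n j * (f (j ℕ.+ 0) * ∏< t (λ i → f (j ℕ.+ suc i)))
      ≡⟨ cong₂ (λ x y → x * (y * ∏< t (λ i → f (j ℕ.+ suc i))))
               (multiples-none j n≡c+1 (ℕP.≤-reflexive (cong suc c+j≡p-1))) f-j ⟩
    + 1 * (+ (n ℕ.+ j) * ∏< t (λ i → f (j ℕ.+ suc i)))
      ≡⟨ cong (λ x → + 1 * (+ (n ℕ.+ j) * x))
              (∏<-one t (λ i i<t → cong +_ (multiplePart-∤ (p∤-residue (after i) (ℕ.s≤s (ℕP.<-trans i<t t<p-1)))))) ⟩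
    + 1 * (+ (n ℕ.+ j) * + 1)                         ≡⟨ lemma (+ (n ℕ.+ j)) ⟩
    + (n ℕ.+ j)                                       ∎
    where
    open ≡-Reasoning
    f : ℕ → ℤ
    f i = + multiplePart (n ℕ.+ i)
    lemma : ∀ x → + 1 * (x * + 1) ≡ x
    lemma = solve-∀
    f-j : f (j ℕ.+ 0) ≡ + (n ℕ.+ j)
    f-j = trans (cong (λ k → + multiplePart (n ℕ.+ k)) (ℕP.+-identityʳ j))
                (cong +_ (multiplePart-∣ (p∣-residue (mod-trans (pos-+-cong-mod j n≡c+1) (mod-reflexive (cong (λ k → + suc k) c+j≡p-1))))))
    after : ∀ i → + (n ℕ.+ (j ℕ.+ suc i)) ≡ + suc i [mod P ]
    after i = mod-trans (pos-+-cong-mod (j ℕ.+ suc i) n≡c+1)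
                (mod-trans (mod-reflexive (cong (λ k → + suc k) (trans (sym (ℕP.+-assoc c j (suc i))) (cong (ℕ._+ suc i) c+j≡p-1))))
                           (∣⇒≡-mod (divides (+ 1) (trans (cong (_- + suc i) (ℤP.pos-+ p (suc i))) (lemma′ P (+ suc i))))))
      where
      lemma′ : ∀ P x → P + x - x ≡ + 1 * P
      lemma′ = solve-∀

  Γ-suc : ∀ {m} → m ℕ.< p → Γ (suc m) ≡ - (-1ℤ ℤ.^ m * + (m !))
  Γ-suc {m} m<p = begin
    Γ (suc m)                                   ≡⟨ ℤP.*-identityˡ (Γ (suc m)) ⟨
    + 1 * Γ (suc m)                             ≡⟨ cong (_* Γ (suc m)) (multiples-none m mod-refl m<p) ⟨
    multiples 1 m * Γ (suc m)                   ≡⟨ Γ-rising 1 m ⟩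
    -1ℤ ℤ.^ m * rising (+ 1) m * Γ 1            ≡⟨ cong (λ x → -1ℤ ℤ.^ m * x * Γ 1) (rising-one m) ⟩
    -1ℤ ℤ.^ m * + (m !) * -1ℤ                   ≡⟨ lemma (-1ℤ ℤ.^ m) (+ (m !)) ⟩
    - (-1ℤ ℤ.^ m * + (m !))                     ∎
    where
    open ≡-Reasoning
    lemma : ∀ s f → s * f * -1ℤ ≡ - (s * f)
    lemma = solve-∀

  private
    difference-pos : ∀ {x y k} → + y - + x ≡ + k * P → y ≡ x ℕ.+ k ℕ.* p
    difference-pos {x} {y} {k} e = ℤP.+-injective (begin
      + y                    ≡⟨ lemma (+ y) (+ x) ⟩
      + x + (+ y - + x)      ≡⟨ cong (_+_ (+ x)) e ⟩
      + x + + k * P          ≡⟨ cong (_+_ (+ x)) (ℤP.pos-* k p) ⟨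
      + x + + (k ℕ.* p)      ≡⟨ ℤP.pos-+ x (k ℕ.* p) ⟨
      + (x ℕ.+ k ℕ.* p)      ∎)
      where
      open ≡-Reasoning
      lemma : ∀ y x → y ≡ x + (y - x)
      lemma = solve-∀

    difference-neg : ∀ {x y k} → + y - + x ≡ -[1+ k ] * P → x ≡ y ℕ.+ suc k ℕ.* p
    difference-neg {x} {y} {k} e = difference-pos {y} {x} {suc k} (begin
      + x - + y                  ≡⟨ lemma (+ x) (+ y) ⟩
      - (+ y - + x)              ≡⟨ cong -_ e ⟩
      - (- + suc k * P)          ≡⟨ cong -_ (ℤP.neg-distribˡ-* (+ suc k) P) ⟨
      - - (+ suc k * P)          ≡⟨ ℤP.neg-involutive (+ suc k * P) ⟩
      + suc k * P                ∎)
      where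
      open ≡-Reasoning
      lemma : ∀ x y → x - y ≡ - (y - x)
      lemma = solve-∀

  module Odd (p-odd : -1ℤ ℤ.^ (p ℕ.∸ 1) ≡ + 1) where

    δ : ℕ → ℤ
    δ x = - window x - + 1

    δ≡0 : ∀ x → δ x ≡ + 0 [mod P ]
    δ≡0 x = sub-cong (neg-cong (mod-trans (window-mod-P x) (mod-trans wilson (mod-reflexive (cong -_ p-odd)))))
                     (mod-refl {x = + 1})

    P∣δ : ∀ x → P ∣ δ x
    P∣δ x = ≡0⇒∣ (δ≡0 x)

    Γ-+p : ∀ x → Γ (x ℕ.+ p) ≡ (+ 1 + δ x) * Γ x
    Γ-+p x = begin
      Γ (x ℕ.+ p)                             ≡⟨ Γ-window x p ⟩
      -1ℤ * -1ℤ ℤ.^ (p ℕ.∸ 1) * window x * Γ x ≡⟨ cong (λ s → -1ℤ * s * window x * Γ x) p-odd ⟩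
      -1ℤ * + 1 * window x * Γ x              ≡⟨ lemma (window x) (Γ x) ⟩
      (+ 1 + δ x) * Γ x                       ∎
      where
      open ≡-Reasoning
      lemma : ∀ W G → -1ℤ * + 1 * W * G ≡ (+ 1 + (- W - + 1)) * G
      lemma = solve-∀

    private
      reflected-factorial : ∀ m → ∏< m (λ i → + suc i - + suc m) ≡ -1ℤ ℤ.^ m * + (m !)
      reflected-factorial m = begin
        ∏< m (λ i → + suc i - + suc m)      ≡⟨ ∏<-cong m (λ i _ → lemma (+ i) (+ m)) ⟩
        ∏< m (λ i → - + m + + i)            ≡⟨ rising-∏< (- + m) m ⟨
        rising (- + m) m                    ≡⟨ rising-neg (+ m) m ⟩
        -1ℤ ℤ.^ m * falling (+ m) m         ≡⟨ cong (-1ℤ ℤ.^ m *_) (trans (falling-reverse (+ 0) m) (rising-one m)) ⟩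
        -1ℤ ℤ.^ m * + (m !)                 ∎
        where
        open ≡-Reasoning
        lemma : ∀ i m → + 1 + i - (+ 1 + m) ≡ - m + i
        lemma = solve-∀

      -- ∏ (i + p) + ∏ (i - p) ≡ 2 ∏ i, and ∏ (i - p) = ∏ i because p - 1 is even
      window-p : window p ≡ window 0 [mod P * P ]
      window-p = begin
        window p                                 ≡⟨ cong₂ _*_ (cong +_ (unitPart-∣ (ℕD.∣-reflexive (sym (ℕP.+-identityʳ p)))))
                                                              (∏<-cong (suc r) (λ i i<p-1 → unitPart-p+ i<p-1)) ⟩
        + 1 * Q₊                                 ≡⟨ ℤP.*-identityˡ Q₊ ⟩
        Q₊                                       ≡⟨ lemma Q₊ Q₋ ⟩
        Q₊ + Q₋ - Q₋                             ≈⟨ sub-cong (∏<-± P (suc r) (λ i → + suc i)) (mod-reflexive Q₋≡Q) ⟩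
        + 2 * Q - Q                              ≡⟨ lemma′ Q ⟩
        Q                                        ≡⟨ trans (factorial-∏< (suc r)) (sym window-zero) ⟩
        window 0                                 ∎
        where
        open ModReasoning (P * P)
        Q Q₊ Q₋ : ℤ
        Q  = ∏< (suc r) (λ i → + suc i)
        Q₊ = ∏< (suc r) (λ i → + suc i + P)
        Q₋ = ∏< (suc r) (λ i → + suc i - P)
        Q₋≡Q : Q₋ ≡ Q
        Q₋≡Q = trans (reflected-factorial (suc r))
                     (trans (cong (_* + (suc r !)) p-odd) (trans (ℤP.*-identityˡ _) (sym (factorial-∏< (suc r)))))
        unitPart-p+ : ∀ {i} → i ℕ.< suc r → + unitPart (p ℕ.+ suc i) ≡ + suc i + P
        unitPart-p+ {i} i<p-1 = trans (cong +_ (unitPart-∤ p∤)) (trans (ℤP.pos-+ p (suc i)) (ℤP.+-comm P (+ suc i)))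
          where
          p∤ : ¬ p ℕD.∣ p ℕ.+ suc i
          p∤ p∣ = ℕP.<⇒≱ (ℕ.s≤s i<p-1) (ℕD.∣⇒≤ (ℕD.∣m+n∣m⇒∣n p∣ (ℕD.∣-refl {p})))
        lemma : ∀ a b → a ≡ a + b - b
        lemma = solve-∀
        lemma′ : ∀ q → + 2 * q - q ≡ q
        lemma′ = solve-∀

      -- (x + p)² ≡ x (x + 2p) (mod p²)
      unitPart-square : ∀ x → + unitPart (x ℕ.+ p) * + unitPart (x ℕ.+ p)
                              ≡ + unitPart x * + unitPart (x ℕ.+ p ℕ.+ p) [mod P * P ]
      unitPart-square x with p ℕD.∣? x
      ... | yes p∣x rewrite unitPart-∣ p∣x | unitPart-∣ (p∣+p p∣x) | unitPart-∣ (p∣+p (p∣+p p∣x)) = mod-refl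
      ... | no  p∤x rewrite unitPart-∤ p∤x | unitPart-∤ (p∤+p p∤x) | unitPart-∤ (p∤+p (p∤+p p∤x)) =
        ∣⇒≡-mod (divides (+ 1) (begin
          + (x ℕ.+ p) * + (x ℕ.+ p) - + x * + (x ℕ.+ p ℕ.+ p)
            ≡⟨ cong₂ (λ u v → u * u - + x * v) (ℤP.pos-+ x p) (trans (ℤP.pos-+ (x ℕ.+ p) p) (cong (_+ P) (ℤP.pos-+ x p))) ⟩
          (+ x + P) * (+ x + P) - + x * (+ x + P + P)
            ≡⟨ lemma (+ x) P ⟩
          + 1 * (P * P) ∎))
        where
        open ≡-Reasoning
        lemma : ∀ x P → (x + P) * (x + P) - x * (x + P + P) ≡ + 1 * (P * P)
        lemma = solve-∀

    window-periodic : ∀ x → window (x ℕ.+ p) ≡ window x [mod P * P ]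
    window-periodic zero    = window-p
    window-periodic (suc x) = cancel-mod-P² (P∤* (P∤unitPart (x ℕ.+ p)) (P∤unitPart (x ℕ.+ p))) (begin
      window (suc x ℕ.+ p) * (v * v)   ≡⟨ ℤP.*-assoc (window (suc x ℕ.+ p)) v v ⟨
      window (suc x ℕ.+ p) * v * v     ≡⟨ cong (_* v) (window-suc (x ℕ.+ p)) ⟩
      window (x ℕ.+ p) * w * v         ≈⟨ *-congʳ v (*-congʳ w (window-periodic x)) ⟩
      window x * w * v                 ≡⟨ lemma (window x) w v ⟩
      window x * v * w                 ≡⟨ cong (_* w) (window-suc x) ⟨
      window (suc x) * u * w           ≡⟨ ℤP.*-assoc (window (suc x)) u w ⟩
      window (suc x) * (u * w)         ≈⟨ *-congˡ (window (suc x)) (mod-sym (unitPart-square x)) ⟩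
      window (suc x) * (v * v)         ∎)
      where
      open ModReasoning (P * P)
      u v w : ℤ
      u = + unitPart x
      v = + unitPart (x ℕ.+ p)
      w = + unitPart (x ℕ.+ p ℕ.+ p)
      lemma : ∀ a b c → a * b * c ≡ a * c * b
      lemma = solve-∀

    δ-periodic : ∀ x k → δ (x ℕ.+ k ℕ.* p) ≡ δ x [mod P * P ]
    δ-periodic x k = sub-cong (neg-cong (periodic k)) (mod-refl {x = + 1})
      where
      periodic : ∀ k → window (x ℕ.+ k ℕ.* p) ≡ window x [mod P * P ]
      periodic zero    = mod-reflexive (cong window (ℕP.+-identityʳ x))
      periodic (suc k) = mod-trans (mod-reflexive (cong window (shift-by-p x k)))
                                   (mod-trans (window-periodic (x ℕ.+ k ℕ.* p)) (periodic k))

    Γ-linear-ℕ : ∀ x k → Γ (x ℕ.+ k ℕ.* p) ≡ Γ x * (+ 1 + + k * δ x) [mod P * P ]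
    Γ-linear-ℕ x zero    = mod-reflexive (trans (cong Γ (ℕP.+-identityʳ x)) (lemma (Γ x) (δ x)))
      where
      lemma : ∀ G d → G ≡ G * (+ 1 + + 0 * d)
      lemma = solve-∀
    Γ-linear-ℕ x (suc k) = begin
      Γ (x ℕ.+ suc k ℕ.* p)                           ≡⟨ cong Γ (shift-by-p x k) ⟩
      Γ (x ℕ.+ k ℕ.* p ℕ.+ p)                         ≡⟨ Γ-+p (x ℕ.+ k ℕ.* p) ⟩
      (+ 1 + δ (x ℕ.+ k ℕ.* p)) * Γ (x ℕ.+ k ℕ.* p)   ≈⟨ *-cong (+-congˡ (+ 1) (δ-periodic x k)) (Γ-linear-ℕ x k) ⟩
      (+ 1 + δ x) * (Γ x * (+ 1 + + k * δ x))         ≡⟨ lemma (Γ x) (+ k) (δ x) ⟩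
      Γ x * (+ 1 + (+ 1 + + k) * δ x) + Γ x * + k * (δ x * δ x)
                                                      ≈⟨ +-congˡ (Γ x * (+ 1 + + suc k * δ x))
                                                           (∣⇒≡0 (∣n⇒∣m*n (Γ x * + k) (*-pres-∣ (P∣δ x) (P∣δ x)))) ⟩
      Γ x * (+ 1 + + suc k * δ x) + + 0               ≡⟨ ℤP.+-identityʳ _ ⟩
      Γ x * (+ 1 + + suc k * δ x)                     ∎
      where
      open ModReasoning (P * P)
      lemma : ∀ G k d → (+ 1 + d) * (G * (+ 1 + k * d)) ≡ G * (+ 1 + (+ 1 + k) * d) + G * k * (d * d)
      lemma = solve-∀

    D : ℕ → ℤ
    D x = quotient (P∣δ x)

    Γ-linear : ∀ {x y} → + y ≡ + x [mod P ] → Γ y ≡ Γ x * (+ 1 + (+ y - + x) * D x) [mod P * P ]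
    Γ-linear {x} {y} (∣⇒≡-mod (divides (+ k) y-x≡kP)) = begin
      Γ y                              ≡⟨ cong Γ y≡x+kp ⟩
      Γ (x ℕ.+ k ℕ.* p)                ≈⟨ Γ-linear-ℕ x k ⟩
      Γ x * (+ 1 + + k * δ x)          ≡⟨ cong (λ d → Γ x * (+ 1 + + k * d)) (_∣_.equality (P∣δ x)) ⟩
      Γ x * (+ 1 + + k * (D x * P))    ≡⟨ cong (λ d → Γ x * (+ 1 + d)) (lemma (+ k) (D x) P) ⟩
      Γ x * (+ 1 + + k * P * D x)      ≡⟨ cong (λ d → Γ x * (+ 1 + d * D x)) y-x≡kP ⟨
      Γ x * (+ 1 + (+ y - + x) * D x)  ∎
      where
      open ModReasoning (P * P)
      lemma : ∀ k d P → k * (d * P) ≡ k * P * d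
      lemma = solve-∀
      y≡x+kp : y ≡ x ℕ.+ k ℕ.* p
      y≡x+kp = difference-pos {x} {y} {k} y-x≡kP
    Γ-linear {x} {y} (∣⇒≡-mod (divides -[1+ k ] y-x≡-sP)) = begin
      Γ y                                                    ≡⟨ lemma₁ (Γ y) s (δ x) ⟩
      Γ y * (+ 1 + s * δ x) * (+ 1 - s * δ x) + Γ y * (s * s) * (δ x * δ x)
                                                             ≈⟨ +-cong (*-congʳ (+ 1 - s * δ x) (mod-sym Γx≡))
                                                                       (∣⇒≡0 (∣n⇒∣m*n (Γ y * (s * s)) (*-pres-∣ (P∣δ x) (P∣δ x)))) ⟩
      Γ x * (+ 1 - s * δ x) + + 0                            ≡⟨ cong (λ d → Γ x * (+ 1 - s * d) + + 0) (_∣_.equality (P∣δ x)) ⟩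
      Γ x * (+ 1 - s * (D x * P)) + + 0                      ≡⟨ lemma₂ (Γ x) s (D x) P ⟩
      Γ x * (+ 1 + (- s * P) * D x)                          ≡⟨ cong (λ d → Γ x * (+ 1 + d * D x)) y-x≡-sP ⟨
      Γ x * (+ 1 + (+ y - + x) * D x)                        ∎
      where
      open ModReasoning (P * P)
      s = + suc k
      x≡y+sp : x ≡ y ℕ.+ suc k ℕ.* p
      x≡y+sp = difference-neg {x} {y} {k} y-x≡-sP
      Γx≡ : Γ x ≡ Γ y * (+ 1 + s * δ x) [mod P * P ]
      Γx≡ = begin
        Γ x                            ≡⟨ cong Γ x≡y+sp ⟩
        Γ (y ℕ.+ suc k ℕ.* p)          ≈⟨ Γ-linear-ℕ y (suc k) ⟩
        Γ y * (+ 1 + s * δ y)          ≈⟨ *-congˡ (Γ y) (+-congˡ (+ 1) (*-congˡ s (mod-sym (δ-periodic y (suc k))))) ⟩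
        Γ y * (+ 1 + s * δ (y ℕ.+ suc k ℕ.* p)) ≡⟨ cong (λ z → Γ y * (+ 1 + s * δ z)) x≡y+sp ⟨
        Γ y * (+ 1 + s * δ x)          ∎
      lemma₁ : ∀ G s d → G ≡ G * (+ 1 + s * d) * (+ 1 - s * d) + G * (s * s) * (d * d)
      lemma₁ = solve-∀
      lemma₂ : ∀ G s D P → G * (+ 1 - s * (D * P)) + + 0 ≡ G * (+ 1 + (- s * P) * D)
      lemma₂ = solve-∀

    Γ-continuous : ∀ {x y} → + y ≡ + x [mod P ] → Γ y ≡ Γ x [mod P ]
    Γ-continuous {x} {y} y≡x = begin
      Γ y                               ≈⟨ mod²⇒mod (Γ-linear y≡x) ⟩
      Γ x * (+ 1 + (+ y - + x) * D x)   ≡⟨ lemma (Γ x) (+ y - + x) (D x) ⟩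
      Γ x + (+ y - + x) * (Γ x * D x)   ≈⟨ +-congˡ (Γ x) (∣⇒≡0 (∣m⇒∣m*n (Γ x * D x) (≡-mod⇒∣ y≡x))) ⟩
      Γ x + + 0                         ≡⟨ ℤP.+-identityʳ (Γ x) ⟩
      Γ x                               ∎
      where
      open ModReasoning P
      lemma : ∀ G d D → G * (+ 1 + d * D) ≡ G + d * (G * D)
      lemma = solve-∀

module Supercongruence (r : ℕ) (p-prime : Prime (suc (suc r))) (p≢2 : suc (suc r) ≢ 2)
                       (α β : ℤₚ (suc (suc r))) where

  open import Data.Nat as ℕ using (ℕ; zero; suc; _!)
  import Data.Nat.Properties as ℕP
  import Data.Nat.Divisibility as ℕD
  open import Data.Integer as ℤ using (ℤ; +_; _+_; _*_; -_; _-_; -1ℤ)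
  import Data.Integer.Properties as ℤP
  open import Data.Integer.Divisibility.Signed using (_∣_; ∣-refl; ∣ᵤ⇒∣; ∣n⇒∣m*n)
  open import Data.Integer.DivMod using (n%ℕd<d)
  open import Data.Integer.Tactic.RingSolver using (solve-∀)
  open import Relation.Binary.PropositionalEquality
  open import Defs using (approx; coherent; modN; ⟨_⟩; ⊖_; ₂F₁-trunc)
  open Congruence
  open Combinatorics
  open ModuloPrime r p-prime
  open Hypergeometric r p-prime
  open MoritaGamma r p-prime
  open Odd (-1ℤ^[p-1]≡1 p≢2)

  a b : ℤ
  a = approx α 2
  b = approx β 2

  A B : ℕ
  A = ⟨ ⊖ approx α ⟩ p
  B = ⟨ ⊖ approx β ⟩ p

  A<p : A ℕ.< p
  A<p = n%ℕd<d (- approx α 1) p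

  B<p : B ℕ.< p
  B<p = n%ℕd<d (- approx β 1) p

  level₂≡-residue : ∀ (γ : ℤₚ p) → approx γ 2 ≡ - + ⟨ ⊖ approx γ ⟩ p [mod P ]
  level₂≡-residue γ = begin
    approx γ 2            ≈⟨ ∣⇒≡-mod (∣ᵤ⇒∣ (subst (ℕD._∣ ℤ.∣ approx γ 2 - approx γ 1 ∣) (ℕP.*-identityʳ p) (coherent γ 1))) ⟩
    approx γ 1            ≡⟨ ℤP.neg-involutive (approx γ 1) ⟨
    - - approx γ 1        ≈⟨ neg-cong (%ℕ-residue (- approx γ 1) p) ⟩
    - + ⟨ ⊖ approx γ ⟩ p  ∎
    where open ModReasoning P

  a≡-A : a ≡ - + A [mod P ]
  a≡-A = level₂≡-residue α

  b≡-B : b ≡ - + B [mod P ]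
  b≡-B = level₂≡-residue β

  N : ℕ
  N = p ℕ.∸ 1

  n₁ n₂ n₃ : ℕ
  n₁ = modN (+ 1 + - a + - b) (p ℕ.^ 2)
  n₂ = modN (+ 1 + - a) (p ℕ.^ 2)
  n₃ = modN (+ 1 + - b) (p ℕ.^ 2)

  n₂≡A+1 : + n₂ ≡ + suc A [mod P ]
  n₂≡A+1 = mod-trans (mod²⇒mod (residue-P² (+ 1 + - a)))
                     (+-congˡ (+ 1) (mod-trans (neg-cong a≡-A) (mod-reflexive (ℤP.neg-involutive (+ A)))))

  n₃≡B+1 : + n₃ ≡ + suc B [mod P ]
  n₃≡B+1 = mod-trans (mod²⇒mod (residue-P² (+ 1 + - b)))
                     (+-congˡ (+ 1) (mod-trans (neg-cong b≡-B) (mod-reflexive (ℤP.neg-involutive (+ B)))))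

  n₁≡A+B+1 : + n₁ ≡ + suc (A ℕ.+ B) [mod P ]
  n₁≡A+B+1 = mod-trans (mod²⇒mod (residue-P² (+ 1 + - a + - b)))
    (mod-trans (+-cong (+-congˡ (+ 1) (neg-cong a≡-A)) (neg-cong b≡-B))
               (mod-reflexive (trans (lemma (+ A) (+ B)) (cong (_+_ (+ 1)) (sym (ℤP.pos-+ A B))))))
    where
    lemma : ∀ A B → + 1 + - - A + - - B ≡ + 1 + (A + B)
    lemma = solve-∀

  pos-+-difference : ∀ n c k → + (n ℕ.+ k) - + (c ℕ.+ k) ≡ + n - + c
  pos-+-difference n c k = trans (cong₂ _-_ (ℤP.pos-+ n k) (ℤP.pos-+ c k)) (lemma (+ n) (+ c) (+ k))
    where
    lemma : ∀ n c k → n + k - (c + k) ≡ n - c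
    lemma = solve-∀

  F : ℤ
  F = hgSum a b N

  ₂F₁≡F : ₂F₁-trunc p (approx α) (approx β) N 2 ≡ F [mod P * P ]
  ₂F₁≡F = mod-reflexive (₂F₁-trunc≡hgSum (approx α) (approx β) N)

  T₁ T₂ T₃ : ℤ
  T₁ = rising (+ n₂) B * I B
  T₂ = rising (+ n₃) A * I A
  T₃ = rising (+ suc A) B * I B

  F≡T₁+T₂-T₃ : F ≡ T₁ + T₂ - T₃ [mod P * P ]
  F≡T₁+T₂-T₃ = begin
    hgSum a b N                                                         ≈⟨ hgSum-split A B N a≡-A b≡-B ⟩
    hgSum a (- + B) N + hgSum (- + A) b N - hgSum (- + A) (- + B) N
      ≡⟨ cong (λ x → hgSum a (- + B) N + x - hgSum (- + A) (- + B) N) (hgSum-comm (- + A) b N) ⟩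
    hgSum a (- + B) N + hgSum b (- + A) N - hgSum (- + A) (- + B) N
      ≈⟨ sub-cong (+-cong (chu-vandermonde a (ℕP.≤-pred B<p) B<p) (chu-vandermonde b (ℕP.≤-pred A<p) A<p))
                                                                                     (chu-vandermonde (- + A) (ℕP.≤-pred B<p) B<p) ⟩
    rising (+ 1 - a) B * I B + rising (+ 1 - b) A * I A - rising (+ 1 - - + A) B * I B
        ≈⟨ sub-cong (+-cong (*-congʳ (I B) (factorialPower-cong-mod -1ℤ B (mod-sym (residue-P² (+ 1 + - a)))))
                            (*-congʳ (I A) (factorialPower-cong-mod -1ℤ A (mod-sym (residue-P² (+ 1 + - b))))))
                    (mod-reflexive (cong (λ x → rising (+ 1 + x) B * I B) (ℤP.neg-involutive (+ A)))) ⟩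
    T₁ + T₂ - T₃ ∎
    where open ModReasoning (P * P)

  rising-Γ : ∀ n {m} → m ℕ.< p → rising (+ n) m * I m * (Γ n * Γ (suc m)) ≡ - (multiples n m * Γ (n ℕ.+ m)) [mod P * P ]
  rising-Γ n {m} m<p = begin
    rising (+ n) m * I m * (Γ n * Γ (suc m))          ≡⟨ cong (λ x → rising (+ n) m * I m * (Γ n * x)) (Γ-suc m<p) ⟩
    rising (+ n) m * I m * (Γ n * - (s * + (m !)))    ≡⟨ lemma (rising (+ n) m) (I m) (Γ n) s (+ (m !)) ⟩
    - (s * rising (+ n) m * Γ n) * (+ (m !) * I m)    ≈⟨ *-congˡ (- (s * rising (+ n) m * Γ n)) (factorial-inverse m<p) ⟩
    - (s * rising (+ n) m * Γ n) * + 1                ≡⟨ cong (λ x → - x * + 1) (Γ-rising n m) ⟨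
    - (multiples n m * Γ (n ℕ.+ m)) * + 1             ≡⟨ ℤP.*-identityʳ _ ⟩
    - (multiples n m * Γ (n ℕ.+ m))                   ∎
    where
    open ModReasoning (P * P)
    s = -1ℤ ℤ.^ m
    lemma : ∀ R J G s f → R * J * (G * - (s * f)) ≡ - (s * R * G) * (f * J)
    lemma = solve-∀

  ΓA ΓB Γ₀ W G : ℤ
  ΓA = Γ (suc A)
  ΓB = Γ (suc B)
  Γ₀ = Γ (suc (A ℕ.+ B))
  W  = Γ n₂ * Γ n₃
  G  = ΓA * ΓB

  X₂ X₃ X₀ : ℤ
  X₂ = Γ (n₂ ℕ.+ B) * Γ n₃ * ΓA
  X₃ = Γ (n₃ ℕ.+ A) * Γ n₂ * ΓB
  X₀ = Γ₀ * Γ n₂ * Γ n₃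

  F*W*G : F * W * G ≡ - (multiples n₂ B * X₂ + multiples n₃ A * X₃ - multiples (suc A) B * X₀) [mod P * P ]
  F*W*G = begin
    F * W * G                                                              ≈⟨ *-congʳ G (*-congʳ W F≡T₁+T₂-T₃) ⟩
    (T₁ + T₂ - T₃) * W * G
      ≡⟨ lemma₁ (rising (+ n₂) B) (rising (+ n₃) A) (rising (+ suc A) B) (I A) (I B) (Γ n₂) (Γ n₃) ΓA ΓB ⟩
    T₁ * (Γ n₂ * ΓB) * (Γ n₃ * ΓA) + T₂ * (Γ n₃ * ΓA) * (Γ n₂ * ΓB) - T₃ * (ΓA * ΓB) * (Γ n₂ * Γ n₃)
      ≈⟨ sub-cong (+-cong (*-congʳ (Γ n₃ * ΓA) (rising-Γ n₂ B<p)) (*-congʳ (Γ n₂ * ΓB) (rising-Γ n₃ A<p)))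
                  (*-congʳ (Γ n₂ * Γ n₃) (rising-Γ (suc A) B<p)) ⟩
    - (multiples n₂ B * Γ (n₂ ℕ.+ B)) * (Γ n₃ * ΓA) + - (multiples n₃ A * Γ (n₃ ℕ.+ A)) * (Γ n₂ * ΓB)
      - - (multiples (suc A) B * Γ₀) * (Γ n₂ * Γ n₃)
      ≡⟨ lemma₂ (multiples n₂ B) (multiples n₃ A) (multiples (suc A) B) (Γ (n₂ ℕ.+ B)) (Γ (n₃ ℕ.+ A)) Γ₀ (Γ n₂) (Γ n₃) ΓA ΓB ⟩
    - (multiples n₂ B * X₂ + multiples n₃ A * X₃ - multiples (suc A) B * X₀) ∎
    where
    open ModReasoning (P * P)
    lemma₁ : ∀ R₂ R₃ R₀ IA IB g₂ g₃ gA gB →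
      (R₂ * IB + R₃ * IA - R₀ * IB) * (g₂ * g₃) * (gA * gB)
        ≡ R₂ * IB * (g₂ * gB) * (g₃ * gA) + R₃ * IA * (g₃ * gA) * (g₂ * gB) - R₀ * IB * (gA * gB) * (g₂ * g₃)
    lemma₁ = solve-∀
    lemma₂ : ∀ M₂ M₃ M₀ h₂ h₃ g₀ g₂ g₃ gA gB →
      - (M₂ * h₂) * (g₃ * gA) + - (M₃ * h₃) * (g₂ * gB) - - (M₀ * g₀) * (g₂ * g₃)
        ≡ - (M₂ * (h₂ * g₃ * gA) + M₃ * (h₃ * g₂ * gB) - M₀ * (g₀ * g₂ * g₃))
    lemma₂ = solve-∀

  cancel-W*G : ∀ X → F * W * G ≡ X * G [mod P * P ] → F ≡ X * W ℤ.^ invExp [mod P * P ]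
  cancel-W*G X FWG≡XG = begin
    F                           ≡⟨ ℤP.*-identityʳ F ⟨
    F * + 1                     ≈⟨ *-congˡ F (mod-sym (inverse-mod-P² (P∤* (P∤Γ n₂) (P∤Γ n₃)))) ⟩
    F * (W * W ℤ.^ invExp)      ≡⟨ ℤP.*-assoc F W (W ℤ.^ invExp) ⟨
    F * W * W ℤ.^ invExp        ≈⟨ *-congʳ (W ℤ.^ invExp) (cancel-mod-P² {F * W} {X} (P∤* (P∤Γ (suc A)) (P∤Γ (suc B))) FWG≡XG) ⟩
    X * W ℤ.^ invExp            ∎
    where open ModReasoning (P * P)

  -- Each Γ-value is expanded to first order around 1 + A, 1 + B or 1 + A + B; the second-order terms are
  -- multiples of p², and the first-order ones cancel because n₁ ≡ n₂ + n₃ - 1 (mod p²).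
  Γ-identity : X₂ + X₃ - X₀ ≡ Γ n₁ * ΓA * ΓB [mod P * P ]
  Γ-identity = begin
    Γ (n₂ ℕ.+ B) * Γ n₃ * ΓA + Γ (n₃ ℕ.+ A) * Γ n₂ * ΓB - Γ₀ * Γ n₂ * Γ n₃
      ≈⟨ sub-cong (+-cong (*-congʳ ΓA (*-cong lin₂ linB)) (*-congʳ ΓB (*-cong lin₃ linA))) (*-cong (*-congˡ Γ₀ linA) linB) ⟩
    Γ₀ * (+ 1 + d₂ * D₀) * (ΓB * (+ 1 + d₃ * DB)) * ΓA + Γ₀ * (+ 1 + d₃ * D₀) * (ΓA * (+ 1 + d₂ * DA)) * ΓB
      - Γ₀ * (ΓA * (+ 1 + d₂ * DA)) * (ΓB * (+ 1 + d₃ * DB))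
      ≡⟨ lemma Γ₀ ΓA ΓB d₂ d₃ D₀ DA DB ⟩
    Γ₀ * (+ 1 + (d₂ + d₃) * D₀) * ΓA * ΓB + Γ₀ * ΓA * ΓB * (D₀ * DB + D₀ * DA - DA * DB) * (d₂ * d₃)
      ≈⟨ +-cong (*-congʳ ΓB (*-congʳ ΓA (*-congˡ Γ₀ (+-congˡ (+ 1) (*-congʳ D₀ (mod-sym d₁≡d₂+d₃))))))
                (∣⇒≡0 (∣n⇒∣m*n (Γ₀ * ΓA * ΓB * (D₀ * DB + D₀ * DA - DA * DB)) (*-pres-∣ (≡-mod⇒∣ n₂≡A+1) (≡-mod⇒∣ n₃≡B+1)))) ⟩
    Γ₀ * (+ 1 + d₁ * D₀) * ΓA * ΓB + + 0
      ≡⟨ ℤP.+-identityʳ _ ⟩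
    Γ₀ * (+ 1 + d₁ * D₀) * ΓA * ΓB
      ≈⟨ *-congʳ ΓB (*-congʳ ΓA (mod-sym (Γ-linear n₁≡A+B+1))) ⟩
    Γ n₁ * ΓA * ΓB ∎
    where
    open ModReasoning (P * P)
    d₁ d₂ d₃ D₀ DA DB : ℤ
    d₁ = + n₁ - + suc (A ℕ.+ B)
    d₂ = + n₂ - + suc A
    d₃ = + n₃ - + suc B
    D₀ = D (suc (A ℕ.+ B))
    DA = D (suc A)
    DB = D (suc B)
    lemma : ∀ g₀ gA gB d₂ d₃ D₀ DA DB →
      g₀ * (+ 1 + d₂ * D₀) * (gB * (+ 1 + d₃ * DB)) * gA + g₀ * (+ 1 + d₃ * D₀) * (gA * (+ 1 + d₂ * DA)) * gB
        - g₀ * (gA * (+ 1 + d₂ * DA)) * (gB * (+ 1 + d₃ * DB))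
      ≡ g₀ * (+ 1 + (d₂ + d₃) * D₀) * gA * gB + g₀ * gA * gB * (D₀ * DB + D₀ * DA - DA * DB) * (d₂ * d₃)
    lemma = solve-∀
    lin₂ : Γ (n₂ ℕ.+ B) ≡ Γ₀ * (+ 1 + d₂ * D₀) [mod P * P ]
    lin₂ = mod-trans (Γ-linear (pos-+-cong-mod B n₂≡A+1))
                     (mod-reflexive (cong (λ d → Γ₀ * (+ 1 + d * D₀)) (pos-+-difference n₂ (suc A) B)))
    lin₃ : Γ (n₃ ℕ.+ A) ≡ Γ₀ * (+ 1 + d₃ * D₀) [mod P * P ]
    lin₃ = subst (λ x → Γ (n₃ ℕ.+ A) ≡ Γ x * (+ 1 + d₃ * D x) [mod P * P ]) (cong suc (ℕP.+-comm B A))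
                 (mod-trans (Γ-linear (pos-+-cong-mod A n₃≡B+1))
                            (mod-reflexive (cong (λ d → Γ (suc B ℕ.+ A) * (+ 1 + d * D (suc B ℕ.+ A))) (pos-+-difference n₃ (suc B) A))))
    linA : Γ n₂ ≡ ΓA * (+ 1 + d₂ * DA) [mod P * P ]
    linA = Γ-linear n₂≡A+1
    linB : Γ n₃ ≡ ΓB * (+ 1 + d₃ * DB) [mod P * P ]
    linB = Γ-linear n₃≡B+1
    d₁≡d₂+d₃ : d₁ ≡ d₂ + d₃ [mod P * P ]
    d₁≡d₂+d₃ = begin
      + n₁ - + suc (A ℕ.+ B)
        ≈⟨ sub-cong (residue-P² (+ 1 + - a + - b)) (mod-reflexive (cong (_+_ (+ 1)) (ℤP.pos-+ A B))) ⟩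
      + 1 + - a + - b - (+ 1 + (+ A + + B))                      ≡⟨ lemma′ a b (+ A) (+ B) ⟩
      (+ 1 + - a - + suc A) + (+ 1 + - b - + suc B)
        ≈⟨ mod-sym (+-cong (sub-cong (residue-P² (+ 1 + - a)) mod-refl) (sub-cong (residue-P² (+ 1 + - b)) mod-refl)) ⟩
      d₂ + d₃                                                    ∎
      where
      lemma′ : ∀ a b A B → + 1 + - a + - b - (+ 1 + (A + B)) ≡ (+ 1 + - a - (+ 1 + A)) + (+ 1 + - b - (+ 1 + B))
      lemma′ = solve-∀

  case₁ : A ℕ.+ B ℕ.< p → F ≡ - (Γ n₁ * W ℤ.^ invExp) [mod P * P ]
  case₁ A+B<p = mod-trans (cancel-W*G (- Γ n₁) (begin
    F * W * G                                                                ≈⟨ F*W*G ⟩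
    - (multiples n₂ B * X₂ + multiples n₃ A * X₃ - multiples (suc A) B * X₀)
      ≡⟨ cong₂ (λ u v → - (u * X₂ + v * X₃ - multiples (suc A) B * X₀))
               (multiples-none B n₂≡A+1 A+B<p) (multiples-none A n₃≡B+1 (subst (ℕ._< p) (ℕP.+-comm A B) A+B<p)) ⟩
    - (+ 1 * X₂ + + 1 * X₃ - multiples (suc A) B * X₀)
      ≡⟨ cong (λ w → - (+ 1 * X₂ + + 1 * X₃ - w * X₀)) (multiples-none B mod-refl A+B<p) ⟩
    - (+ 1 * X₂ + + 1 * X₃ - + 1 * X₀)                                       ≡⟨ lemma₁ X₂ X₃ X₀ ⟩
    - (X₂ + X₃ - X₀)                                                         ≈⟨ neg-cong Γ-identity ⟩
    - (Γ n₁ * ΓA * ΓB)                                                       ≡⟨ lemma₂ (Γ n₁) ΓA ΓB ⟩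
    - Γ n₁ * G                                                               ∎))
    (mod-reflexive (sym (ℤP.neg-distribˡ-* (Γ n₁) (W ℤ.^ invExp))))
    where
    open ModReasoning (P * P)
    lemma₁ : ∀ x y z → - (+ 1 * x + + 1 * y - + 1 * z) ≡ - (x + y - z)
    lemma₁ = solve-∀
    lemma₂ : ∀ g a b → - (g * a * b) ≡ - g * (a * b)
    lemma₂ = solve-∀

  case₂ : p ℕ.≤ A ℕ.+ B → F ≡ (a + b + (+ (A ℕ.+ B) - P)) * (Γ n₁ * W ℤ.^ invExp) [mod P * P ]
  case₂ p≤A+B = mod-trans (cancel-W*G (c * Γ n₁) (begin
    F * W * G                                                                ≈⟨ F*W*G ⟩
    - (multiples n₂ B * X₂ + multiples n₃ A * X₃ - multiples (suc A) B * X₀)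
      ≡⟨ cong₂ (λ u v → - (u * X₂ + v * X₃ - multiples (suc A) B * X₀)) M₂≡e₂ M₃≡e₃ ⟩
    - (e₂ * X₂ + e₃ * X₃ - multiples (suc A) B * X₀)
      ≡⟨ cong (λ w → - (e₂ * X₂ + e₃ * X₃ - w * X₀)) M₀≡P ⟩
    - (e₂ * X₂ + e₃ * X₃ - P * X₀)
      ≈⟨ neg-cong (sub-cong (+-cong (*-congˡ-mod² P∣e₂ X₂≡) (*-congˡ-mod² P∣e₃ X₃≡)) (*-congˡ-mod² ∣-refl X₀≡)) ⟩
    - (e₂ * (Γ₀ * G) + e₃ * (Γ₀ * G) - P * (Γ₀ * G))                         ≡⟨ lemma₁ e₂ e₃ P (Γ₀ * G) ⟩
    - (e₂ + e₃ - P) * (Γ₀ * G)                                               ≈⟨ *-congʳ (Γ₀ * G) (neg-cong e₂+e₃-P≡-c) ⟩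
    - - c * (Γ₀ * G)                                                         ≡⟨ cong (_* (Γ₀ * G)) (ℤP.neg-involutive c) ⟩
    c * (Γ₀ * G)
      ≈⟨ *-congˡ-mod² P∣c (*-congʳ G (mod-sym (Γ-continuous n₁≡A+B+1))) ⟩
    c * (Γ n₁ * G)                                                           ≡⟨ ℤP.*-assoc c (Γ n₁) G ⟨
    c * Γ n₁ * G                                                             ∎))
    (mod-reflexive (ℤP.*-assoc c (Γ n₁) (W ℤ.^ invExp)))
    where
    open ModReasoning (P * P)
    c : ℤ
    c = a + b + (+ (A ℕ.+ B) - P)
    j₀ i₀ t : ℕ
    j₀ = N ℕ.∸ A
    i₀ = N ℕ.∸ B
    t  = A ℕ.+ B ℕ.∸ p
    e₂ e₃ : ℤ
    e₂ = + (n₂ ℕ.+ j₀)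
    e₃ = + (n₃ ℕ.+ i₀)
    lemma₃ : ∀ g b a → g * b * a ≡ g * (a * b)
    lemma₃ = solve-∀
    A+j₀≡N : A ℕ.+ j₀ ≡ N
    A+j₀≡N = ℕP.m+[n∸m]≡n (ℕP.≤-pred A<p)
    B+i₀≡N : B ℕ.+ i₀ ≡ N
    B+i₀≡N = ℕP.m+[n∸m]≡n (ℕP.≤-pred B<p)
    N+t+1≡A+B : N ℕ.+ suc t ≡ A ℕ.+ B
    N+t+1≡A+B = trans (ℕP.+-suc N t) (ℕP.m+[n∸m]≡n p≤A+B)
    j₀+t+1≡B : j₀ ℕ.+ suc t ≡ B
    j₀+t+1≡B = ℕP.+-cancelˡ-≡ A _ _ (trans (sym (ℕP.+-assoc A j₀ (suc t))) (trans (cong (ℕ._+ suc t) A+j₀≡N) N+t+1≡A+B))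
    i₀+t+1≡A : i₀ ℕ.+ suc t ≡ A
    i₀+t+1≡A = ℕP.+-cancelˡ-≡ B _ _ (trans (sym (ℕP.+-assoc B i₀ (suc t)))
                                           (trans (cong (ℕ._+ suc t) B+i₀≡N) (trans N+t+1≡A+B (ℕP.+-comm A B))))
    t<N : t ℕ.< N
    t<N = ℕP.+-cancelˡ-≤ N _ _ (ℕP.≤-trans (ℕP.≤-reflexive N+t+1≡A+B) (ℕP.+-mono-≤ (ℕP.≤-pred A<p) (ℕP.≤-pred B<p)))
    lemma₁ : ∀ e₂ e₃ P X → - (e₂ * X + e₃ * X - P * X) ≡ - (e₂ + e₃ - P) * X
    lemma₁ = solve-∀
    M₂≡e₂ : multiples n₂ B ≡ e₂
    M₂≡e₂ = subst (λ m → multiples n₂ m ≡ e₂) j₀+t+1≡B (multiples-one t n₂≡A+1 A+j₀≡N t<N)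
    M₃≡e₃ : multiples n₃ A ≡ e₃
    M₃≡e₃ = subst (λ m → multiples n₃ m ≡ e₃) i₀+t+1≡A (multiples-one t n₃≡B+1 B+i₀≡N t<N)
    M₀≡P : multiples (suc A) B ≡ P
    M₀≡P = subst₂ (λ m k → multiples (suc A) m ≡ + suc k) j₀+t+1≡B A+j₀≡N (multiples-one {suc A} {A} {j₀} t mod-refl A+j₀≡N t<N)
    P∣e₂ : P ∣ e₂
    P∣e₂ = ≡0⇒∣ (mod-trans (pos-+-cong-mod j₀ n₂≡A+1) (mod-trans (mod-reflexive (cong (λ k → + suc k) A+j₀≡N)) (∣⇒≡0 ∣-refl)))
    P∣e₃ : P ∣ e₃
    P∣e₃ = ≡0⇒∣ (mod-trans (pos-+-cong-mod i₀ n₃≡B+1) (mod-trans (mod-reflexive (cong (λ k → + suc k) B+i₀≡N)) (∣⇒≡0 ∣-refl)))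
    P∣c : P ∣ c
    P∣c = ≡0⇒∣ (mod-trans (+-congʳ (+ (A ℕ.+ B) - P) (+-cong a≡-A b≡-B))
                          (mod-trans (mod-reflexive (trans (cong (λ x → - + A + - + B + (x - P)) (ℤP.pos-+ A B)) (lemma₂ (+ A) (+ B) P)))
                                     (neg-cong {x = P} (∣⇒≡0 ∣-refl))))
      where
      lemma₂ : ∀ A B P → - A + - B + (A + B - P) ≡ - P
      lemma₂ = solve-∀
    X₂≡ : X₂ ≡ Γ₀ * G [mod P ]
    X₂≡ = mod-trans (*-congʳ ΓA (*-cong (Γ-continuous (pos-+-cong-mod B n₂≡A+1)) (Γ-continuous n₃≡B+1)))
                    (mod-reflexive (lemma₃ Γ₀ ΓB ΓA))
    X₃≡ : X₃ ≡ Γ₀ * G [mod P ]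
    X₃≡ = mod-trans (*-congʳ ΓB (*-cong (mod-trans (Γ-continuous (pos-+-cong-mod A n₃≡B+1)) (mod-reflexive (cong (λ k → Γ (suc k)) (ℕP.+-comm B A))))
                                        (Γ-continuous n₂≡A+1)))
                    (mod-reflexive (ℤP.*-assoc Γ₀ ΓA ΓB))
    X₀≡ : X₀ ≡ Γ₀ * G [mod P ]
    X₀≡ = mod-trans (*-cong (*-congˡ Γ₀ (Γ-continuous n₂≡A+1)) (Γ-continuous n₃≡B+1)) (mod-reflexive (ℤP.*-assoc Γ₀ ΓA ΓB))
    e₂+e₃-P≡-c : e₂ + e₃ - P ≡ - c [mod P * P ]
    e₂+e₃-P≡-c = begin
      + (n₂ ℕ.+ j₀) + + (n₃ ℕ.+ i₀) - P              ≡⟨ cong₂ (λ x y → x + y - P) (ℤP.pos-+ n₂ j₀) (ℤP.pos-+ n₃ i₀) ⟩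
      + n₂ + + j₀ + (+ n₃ + + i₀) - P
        ≈⟨ sub-cong (+-cong (+-congʳ (+ j₀) (residue-P² (+ 1 + - a))) (+-congʳ (+ i₀) (residue-P² (+ 1 + - b)))) mod-refl ⟩
      + 1 + - a + + j₀ + (+ 1 + - b + + i₀) - P
        ≡⟨ cong₂ (λ x y → + 1 + - a + x + (+ 1 + - b + y) - P) (complement A+j₀≡N) (complement B+i₀≡N) ⟩
      + 1 + - a + (+ N - + A) + (+ 1 + - b + (+ N - + B)) - (+ 1 + + N)
                                                     ≡⟨ lemma₄ a b (+ A) (+ B) (+ N) ⟩
      - (a + b + (+ A + + B - (+ 1 + + N)))          ≡⟨ cong (λ x → - (a + b + (x - P))) (ℤP.pos-+ A B) ⟨
      - c                                            ∎
      where
      complement : ∀ {x y} → x ℕ.+ y ≡ N → + y ≡ + N - + x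
      complement {x} {y} eq = trans (lemma₅ (+ x) (+ y)) (cong (_- + x) (trans (sym (ℤP.pos-+ x y)) (cong +_ eq)))
        where
        lemma₅ : ∀ x y → y ≡ x + y - x
        lemma₅ = solve-∀
      lemma₄ : ∀ a b A B N → + 1 + - a + (N - A) + (+ 1 + - b + (N - B)) - (+ 1 + N) ≡ - (a + b + (A + B - (+ 1 + N)))
      lemma₄ = solve-∀

open import Data.Nat as ℕ using (_+_; _<_; _≥_)
open import Data.Integer as ℤ using (+_)
open Congruence using (mod-trans)

theorem1p1 : (p : ℕ) → Prime p → p ≢ 2 → (α β : ℤₚ p) →
    let a = approx α
        b = approx β
        one = cst (+ 1)
        ratio = Γp p (one ⊕ ⊖ a ⊕ ⊖ b) ⊗ inv p (Γp p (one ⊕ ⊖ a) ⊗ Γp p (one ⊕ ⊖ b))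
        s = ⟨_⟩ (⊖ a) p + ⟨_⟩ (⊖ b) p
    in (s < p → ₂F₁-trunc p a b (p ℕ.∸ 1) ≡ ⊖ ratio [modp² p ])
     × (s ≥ p → ₂F₁-trunc p a b (p ℕ.∸ 1) ≡ (a ⊕ b ⊕ cst (+ s ℤ.- + p)) ⊗ ratio [modp² p ])
theorem1p1 zero          p-prime = ⊥-elim (¬prime[0] p-prime)
theorem1p1 (suc zero)    p-prime = ⊥-elim (¬prime[1] p-prime)
theorem1p1 (suc (suc r)) p-prime p≢2 α β =
  (λ s<p → mod-P²⇒modp² (mod-trans ₂F₁≡F (case₁ s<p))) , (λ s≥p → mod-P²⇒modp² (mod-trans ₂F₁≡F (case₂ s≥p)))
  where
  open ModuloPrime r p-prime using (mod-P²⇒modp²)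
  open Supercongruence r p-prime p≢2 α β
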